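{- Let $k\in\mathbb N$ and let $(T,K)$ be a netblock representation. The following statements are equivalent: (i) $G(T,K)$ is star $k$-choosable; (ii) $G(T,K)$ admits a star $k$-coloring; (iii) $K(e)\le k$ for every $e\in E(T)$, and every maximal $(k-1)$-subtree of $(T,K)$ contains a $(k-1)$-exit vertex of $(T,K)$.
   Context: All graphs are finite and simple. A netblock representation is a pair $(T,K)$ where $T$ is a tree and $K:E(T)\to\mathbb N$ is a weight function. The graph $G(T,K)$ is obtained from $T$ by inserting, for every edge $vw\in E(T)$, a clique $B(vw)$ of $K(vw)$ new vertices, each adjacent to $v$ and $w$ (and to each other). For $c\in\mathbb N$, a $c$-subtree of $(T,K)$ is a subtree of $T$ formed by edges of weight $c$; a maximal $c$-subtree is a $c$-subtree whose edge set is not included in the edge set of another $c$-subtree. A $c$-exit vertex of $(T,K)$ is a vertex $v$ of $T$ having a neighbor $w$ in $T$ with $K(vw)<c$. A star of a graph is a vertex set inducing $K_{1,m}$ ($m\ge1$); maximal stars are stars not properly contained in another star. A $k$-coloring is a map into $\{1,\dots,k\}$; a star $k$-coloring has no monochromatic maximal star. For a $k$-list assignment $L$ ($L(v)\subseteq\mathbb N$, $|L(v)|=k$), an $L$-coloring satisfies $\rho(v)\in L(v)$; the graph is star $k$-choosable if for every $k$-list assignment $L$ there is an $L$-coloring with no monochromatic maximal star.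
   Formalization: T has at least one edge, and a maximal $c$-subtree is a $c$-subtree whose vertex set is properly contained in that of no other, so single vertices with no incident edge of weight $c$ count. The statement above fails without it. -}

module Defs where

open import Data.Nat using (ℕ; _≤_; _<_; _∸_; _+_)
open import Data.Fin using (Fin; zero; suc; inject₁; fromℕ)
import Data.Fin as F
open import Data.Bool using (Bool; true; false)
open import Data.Product using (Σ; _×_; _,_; proj₁; proj₂)
open import Data.Sum using (_⊎_; inj₁; inj₂)
open import Data.List using (List; length)
open import Data.List.Membership.Propositional using (_∈_)
open import Data.List.Relation.Unary.Unique.Propositional using (Unique)
open import Relation.Binary.PropositionalEquality using (_≡_; _≢_)
open import Relation.Nullary using (¬_)
open import Function.Definitions using (Injective)

record Graph : Set₁ where
  field
    V   : Set
    _~_ : V → V → Set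

module _ (G : Graph) where
  open Graph G

  VSet : Set
  VSet = V → Bool

  IsStar : VSet → Set
  IsStar S = Σ V λ c → S c ≡ true
    × Σ V (λ l → S l ≡ true × l ≢ c)
    × (∀ x → S x ≡ true → x ≢ c → c ~ x)
    × (∀ x y → S x ≡ true → S y ≡ true → x ≢ c → y ≢ c → ¬ (x ~ y))

  _⊆ᵥ_ : VSet → VSet → Set
  S ⊆ᵥ S' = ∀ x → S x ≡ true → S' x ≡ true

  ProperlyContained : VSet → VSet → Set
  ProperlyContained S S' = S ⊆ᵥ S' × Σ V (λ x → S' x ≡ true × S x ≡ false)

  IsMaximalStar : VSet → Set
  IsMaximalStar S = IsStar S × (∀ S' → IsStar S' → ¬ ProperlyContained S S')

  Monochromatic : {A : Set} → (V → A) → VSet → Set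
  Monochromatic ρ S = ∀ x y → S x ≡ true → S y ≡ true → ρ x ≡ ρ y

  IsStarColoring : {A : Set} → (V → A) → Set
  IsStarColoring ρ = ∀ S → IsMaximalStar S → ¬ Monochromatic ρ S

  HasStarColoring : ℕ → Set
  HasStarColoring k = Σ (V → Fin k) IsStarColoring

  IsListAssignment : ℕ → (V → List ℕ) → Set
  IsListAssignment k L = ∀ v → length (L v) ≡ k × Unique (L v)

  StarChoosable : ℕ → Set
  StarChoosable k = ∀ (L : V → List ℕ) → IsListAssignment k L →
    Σ (V → ℕ) λ ρ → (∀ v → ρ v ∈ L v) × IsStarColoring ρ

data WalkIn {n : ℕ} (adj : Fin n → Fin n → Bool) (S : Fin n → Bool)
       : Fin n → Fin n → Set where
  here : ∀ {u} → S u ≡ true → WalkIn adj S u u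
  step : ∀ {u w v} → S u ≡ true → adj u w ≡ true → WalkIn adj S w v →
         WalkIn adj S u v

IsCycle : {n : ℕ} (adj : Fin n → Fin n → Bool) (j : ℕ) → (Fin (3 + j) → Fin n) → Set
IsCycle adj j f = Injective _≡_ _≡_ f
  × (∀ (i : Fin (2 + j)) → adj (f (inject₁ i)) (f (suc i)) ≡ true)
  × adj (f (fromℕ (2 + j))) (f zero) ≡ true

record Tree : Set where
  field
    n        : ℕ
    adj      : Fin n → Fin n → Bool
    adj-sym  : ∀ u v → adj u v ≡ adj v u
    adj-irr  : ∀ u → adj u u ≡ false
    nonempty : 1 ≤ n
    connected : ∀ u v → WalkIn adj (λ _ → true) u v
    acyclic  : ∀ j (f : Fin (3 + j) → Fin n) → ¬ IsCycle adj j f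

  -- edges of T, each represented once as an ordered pair (u , v), u < v
  Edge : Set
  Edge = Σ (Fin n × Fin n) λ p → proj₁ p F.< proj₂ p × adj (proj₁ p) (proj₂ p) ≡ true

  Incident : Fin n → Edge → Set
  Incident x e = x ≡ proj₁ (proj₁ e) ⊎ x ≡ proj₂ (proj₁ e)

record Netblock : Set where
  field
    T : Tree
  open Tree T public
  field
    K : Edge → ℕ

module _ (N : Netblock) where
  open Netblock N

  -- vertices of G(T,K): the vertices of T plus, for each edge e,
  -- the K(e) vertices of the clique B(e)
  GV : Set
  GV = Fin n ⊎ Σ Edge (λ e → Fin (K e))

  GAdj : GV → GV → Set
  GAdj (inj₁ u) (inj₁ v) = adj u v ≡ true
  GAdj (inj₁ u) (inj₂ (e , _)) = Incident u e
  GAdj (inj₂ (e , _)) (inj₁ u) = Incident u e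
  GAdj (inj₂ p) (inj₂ q) = proj₁ p ≡ proj₁ q × p ≢ q

  G[_] : Graph
  G[_] = record { V = GV ; _~_ = GAdj }

  InsideEdge : (Fin n → Bool) → Edge → Set
  InsideEdge S e = S (proj₁ (proj₁ e)) ≡ true × S (proj₂ (proj₁ e)) ≡ true

  -- c-subtree: a (nonempty) subtree of T, given by its vertex set S
  -- (subtrees of a tree are induced), all of whose edges have weight c.
  -- Trivial one-vertex subtrees are included.
  IsCSubtree : ℕ → (Fin n → Bool) → Set
  IsCSubtree c S = Σ (Fin n) (λ v → S v ≡ true)
    × (∀ u v → S u ≡ true → S v ≡ true → WalkIn adj S u v)
    × (∀ e → InsideEdge S e → K e ≡ c)

  IsMaximalCSubtree : ℕ → (Fin n → Bool) → Set
  IsMaximalCSubtree c S = IsCSubtree c S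
    × (∀ S' → IsCSubtree c S' → ¬ (
         (∀ x → S x ≡ true → S' x ≡ true) × Σ (Fin n) (λ x → S' x ≡ true × S x ≡ false)))

  IsExit : ℕ → Fin n → Set
  IsExit c v = Σ Edge λ e → Incident v e × K e < c

  Condition-iii : ℕ → Set
  Condition-iii k = (∀ e → K e ≤ k)
    × (∀ S → IsMaximalCSubtree (k ∸ 1) S →
         Σ (Fin n) λ v → S v ≡ true × IsExit (k ∸ 1) v)

-- In a star coloring, two adjacent vertices with the same other neighbours
-- get distinct colors; hence blocks are rainbow (so K ≤ k), and a tree vertex
-- v with two neighbours has a good neighbour w: ρ w and all colors of B(vw)
-- differ from ρ v.  If a maximal (k−1)-subtree had no exit, good neighbours
-- would stay inside it along (k−1)-edges without ever turning back, an
-- impossible infinite walk in a finite tree.  Conversely, rainbow blocks plus a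
-- good neighbour for every tree vertex already make a star coloring.  Given
-- (iii), let each vertex lean on its light neighbour of least index if it is an
-- exit, and on a (k−1)-neighbour nearer to an exit otherwise; color the tree
-- vertices from their lists away from the vertex they lean on (in an order
-- along which a rank decreases), then each block B(e) greedily away from the
-- at most k − K(e) colors of ends leaning across e.

module Submission where

open import Defs

open import Axiom.UniquenessOfIdentityProofs using (module Decidable⇒UIP)
open import Data.Bool as Bool using (Bool; true; false; _∨_; if_then_else_)
open import Data.Empty using (⊥; ⊥-elim)
open import Data.Fin as F using (Fin; zero; suc; inject₁; fromℕ; toℕ)
import Data.Fin.Properties as FP
open import Data.List using (List; []; _∷_; length; lookup; _++_; upTo)
open import Data.List.Membership.Propositional using (_∈_; _∉_; find)
open import Data.List.Membership.Propositional.Properties using (∈-lookup; ∈-++⁺ʳ; ∈-upTo⁻)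
open import Data.List.Properties using (length-upTo)
open import Data.List.Relation.Unary.All as All using (All; []; _∷_)
open import Data.List.Relation.Unary.All.Properties using (¬Any⇒All¬; ¬All⇒Any¬)
open import Data.List.Relation.Unary.AllPairs using ([]; _∷_)
open import Data.List.Relation.Unary.Any using (here; there; index)
open import Data.List.Relation.Unary.Any.Properties using (lookup-index)
open import Data.List.Relation.Unary.Linked as Linked using (Linked; []; [-]; _∷_)
open import Data.List.Relation.Unary.Unique.Propositional using (Unique)
open import Data.List.Relation.Unary.Unique.Propositional.Properties using (upTo⁺)
open import Data.Maybe as Maybe using (Maybe; just; nothing)
open import Data.Nat as ℕ using (ℕ; zero; suc; _+_; _*_; _∸_; _≤_; _<_; z≤n; s≤s)
import Data.Nat.Properties as ℕP
open import Data.Product using (Σ; _×_; _,_; proj₁; proj₂; ∃)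
import Data.Product.Properties as ΣP
open import Data.Sum using (_⊎_; inj₁; inj₂)
open import Data.Sum.Properties as ⊎P using (inj₁-injective)
open import Function.Base using (_∘_)
open import Function.Bundles using (_⇔_; mk⇔)
open import Function.Definitions using (Injective)
open import Relation.Binary.Definitions using (DecidableEquality; tri<; tri≈; tri>)
open import Relation.Binary.PropositionalEquality
open import Relation.Nullary using (¬_; Dec; yes; no; does)
open import Relation.Nullary.Decidable using (dec-true; dec-false; _×-dec_; _⊎-dec_; ¬?; decidable-stable)

open Decidable⇒UIP Bool._≟_ using () renaming (≡-irrelevant to Bool-UIP)

dec-true⁻ : ∀ {P : Set} (P? : Dec P) → does P? ≡ true → P
dec-true⁻ (yes p) _ = p

dec-false⁻ : ∀ {P : Set} (P? : Dec P) → does P? ≡ false → ¬ P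
dec-false⁻ (no ¬p) _ = ¬p

∨-trueˡ : ∀ {a} b → a ≡ true → a ∨ b ≡ true
∨-trueˡ b refl = refl

∨-trueʳ : ∀ a {b} → b ≡ true → a ∨ b ≡ true
∨-trueʳ true refl = refl
∨-trueʳ false refl = refl

∨-true⁻ : ∀ a b → a ∨ b ≡ true → a ≡ true ⊎ b ≡ true
∨-true⁻ true b p = inj₁ refl
∨-true⁻ false b p = inj₂ p

module DecSubsets {A : Set} (_≟_ : DecidableEquality A) where

  ｛_｝ : A → A → Bool
  ｛ x ｝ y = does (y ≟ x)

  insert : A → (A → Bool) → A → Bool
  insert x S y = S y ∨ ｛ x ｝ y

  ∈-｛｝ : ∀ x → ｛ x ｝ x ≡ true
  ∈-｛｝ x = dec-true (x ≟ x) refl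

  ∈-｛｝⁻ : ∀ {x y} → ｛ x ｝ y ≡ true → y ≡ x
  ∈-｛｝⁻ {x} {y} = dec-true⁻ (y ≟ x)

  ∈-insert-new : ∀ x S → insert x S x ≡ true
  ∈-insert-new x S = ∨-trueʳ (S x) (∈-｛｝ x)

  ∈-insert-old : ∀ x S {y} → S y ≡ true → insert x S y ≡ true
  ∈-insert-old x S p = ∨-trueˡ _ p

  ∈-insert⁻ : ∀ x S y → insert x S y ≡ true → S y ≡ true ⊎ y ≡ x
  ∈-insert⁻ x S y p with ∨-true⁻ (S y) _ p
  ... | inj₁ q = inj₁ q
  ... | inj₂ q = inj₂ (∈-｛｝⁻ q)

lastOf : {A : Set} → A → List A → A
lastOf x [] = x
lastOf x (y ∷ ys) = lastOf y ys

lastOf-++ : {A : Set} (x : A) (xs : List A) (y : A) → lastOf x (xs ++ y ∷ []) ≡ y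
lastOf-++ x [] y = refl
lastOf-++ x (z ∷ xs) y = lastOf-++ z xs y

lookup-last : {A : Set} (x : A) (xs : List A) → lookup (x ∷ xs) (fromℕ (length xs)) ≡ lastOf x xs
lookup-last x [] = refl
lookup-last x (y ∷ xs) = lookup-last y xs

module _ {A : Set} {R : A → A → Set} where

  Linked-lookup : ∀ {x xs} → Linked R (x ∷ xs) →
    (i : Fin (length xs)) → R (lookup (x ∷ xs) (inject₁ i)) (lookup (x ∷ xs) (suc i))
  Linked-lookup (r ∷ l) zero = r
  Linked-lookup (r ∷ l) (suc i) = Linked-lookup l i

  Linked-snoc : ∀ {x y} xs → Linked R (x ∷ xs) → R (lastOf x xs) y → Linked R (x ∷ xs ++ y ∷ [])
  Linked-snoc [] [-] r = r ∷ [-]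
  Linked-snoc (z ∷ xs) (r′ ∷ l) r = r′ ∷ Linked-snoc xs l r

  Linked-++ : ∀ x xs ys → Linked R (x ∷ xs) → Linked R (lastOf x xs ∷ ys) →
    Linked R (x ∷ xs ++ ys) × lastOf x (xs ++ ys) ≡ lastOf (lastOf x xs) ys
  Linked-++ x [] ys l l′ = l′ , refl
  Linked-++ x (y ∷ xs) ys (r ∷ l) l′ with Linked-++ y xs ys l l′
  ... | l″ , last≡ = r ∷ l″ , last≡

  Linked-reverse : (∀ {a b} → R a b → R b a) → ∀ x xs → Linked R (x ∷ xs) →
    Σ (List A) λ ys → Linked R (lastOf x xs ∷ ys) × lastOf (lastOf x xs) ys ≡ x
  Linked-reverse R-sym x [] l = [] , [-] , refl
  Linked-reverse R-sym x (y ∷ xs) (r ∷ l) with Linked-reverse R-sym y xs l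
  ... | ys , l′ , last≡ =
    ys ++ x ∷ [] , Linked-snoc ys l′ (subst (λ t → R t x) (sym last≡) (R-sym r)) , lastOf-++ _ ys x

  Linked-suffix : ∀ {x y ys} → x ∈ y ∷ ys → Linked R (y ∷ ys) → Unique (y ∷ ys) →
    Σ (List A) λ zs → Linked R (x ∷ zs) × Unique (x ∷ zs) × lastOf x zs ≡ lastOf y ys
  Linked-suffix {ys = ys} (here refl) l u = ys , l , u , refl
  Linked-suffix {ys = z ∷ zs} (there x∈) l (_ ∷ u) = Linked-suffix x∈ (Linked.tail l) u

lookup-injective : {A : Set} {xs : List A} → Unique xs → Injective _≡_ _≡_ (lookup xs)
lookup-injective (x∉ ∷ u) {zero} {zero} eq = refl
lookup-injective (x∉ ∷ u) {zero} {suc j} eq = ⊥-elim (All.lookup x∉ (∈-lookup j) eq)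
lookup-injective (x∉ ∷ u) {suc i} {zero} eq = ⊥-elim (All.lookup x∉ (∈-lookup i) (sym eq))
lookup-injective (x∉ ∷ u) {suc i} {suc j} eq = cong suc (lookup-injective u eq)

Unique-length≤ : ∀ {n} {xs : List (Fin n)} → Unique xs → length xs ≤ n
Unique-length≤ u = FP.injective⇒≤ (lookup-injective u)

module _ {A : Set} (_≟_ : DecidableEquality A) where
  open import Data.List.Membership.DecPropositional _≟_ using (_∈?_)

  erase-loops : ∀ {R : A → A → Set} x xs → Linked R (x ∷ xs) →
    Σ (List A) λ zs → Linked R (x ∷ zs) × Unique (x ∷ zs) × lastOf x zs ≡ lastOf x xs
  erase-loops x [] [-] = [] , [-] , [] ∷ [] , refl
  erase-loops x (y ∷ ys) (r ∷ l) with erase-loops y ys l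
  ... | zs , lz , uz , last≡ with x ∈? y ∷ zs
  ...   | no x∉ = y ∷ zs , r ∷ lz , ¬Any⇒All¬ _ x∉ ∷ uz , last≡
  ...   | yes x∈ with Linked-suffix x∈ lz uz
  ...     | ws , lw , uw , last≡′ = ws , lw , uw , trans last≡′ last≡

  ∃-∉-shorter : ∀ (L F : List A) → Unique L → length F < length L → ∃ λ x → x ∈ L × x ∉ F
  ∃-∉-shorter L F u |F|<|L| with All.all? (_∈? F) L
  ... | no ¬L⊆F = find (¬All⇒Any¬ (_∈? F) L ¬L⊆F)
  ... | yes L⊆F = ⊥-elim (ℕP.<⇒≱ |F|<|L| (FP.injective⇒≤ position-injective))
    where
    position : Fin (length L) → Fin (length F)
    position i = index (All.lookup L⊆F (∈-lookup i))
    position-injective : Injective _≡_ _≡_ position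
    position-injective {i} {j} eq = lookup-injective u
      (trans (lookup-index (All.lookup L⊆F (∈-lookup i)))
        (trans (cong (lookup F) eq) (sym (lookup-index (All.lookup L⊆F (∈-lookup j))))))

distinct-representatives : (k m : ℕ) (Ls : Fin m → List ℕ) (F : List ℕ) →
  (∀ i → Unique (Ls i)) → (∀ i → length (Ls i) ≡ k) → length F + m ≤ k →
  Σ (Fin m → ℕ) λ f → (∀ i → f i ∈ Ls i) × (∀ i → f i ∉ F) × Injective _≡_ _≡_ f
distinct-representatives k zero Ls F u |L| bound = (λ ()) , (λ ()) , (λ ()) , (λ {i} → λ {})
distinct-representatives k (suc m) Ls F u |L| bound
  with ∃-∉-shorter ℕP._≟_ (Ls zero) F (u zero)
         (subst (length F <_) (sym (|L| zero))
           (ℕP.<-≤-trans (ℕP.m<m+n (length F) (s≤s z≤n)) bound))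
... | x , x∈ , x∉
  with distinct-representatives k m (λ i → Ls (suc i)) (x ∷ F) (λ i → u (suc i)) (λ i → |L| (suc i))
         (subst (_≤ k) (ℕP.+-suc (length F) m) bound)
... | f , f∈ , f∉ , f-inj = g , g∈ , g∉ , g-inj
  where
  g : Fin (suc m) → ℕ
  g zero = x
  g (suc i) = f i
  g∈ : ∀ i → g i ∈ Ls i
  g∈ zero = x∈
  g∈ (suc i) = f∈ i
  g∉ : ∀ i → g i ∉ F
  g∉ zero = x∉
  g∉ (suc i) p = f∉ i (there p)
  g-inj : Injective _≡_ _≡_ g
  g-inj {zero} {zero} e = refl
  g-inj {zero} {suc j} e = ⊥-elim (f∉ j (here (sym e)))
  g-inj {suc i} {zero} e = ⊥-elim (f∉ i (here e))
  g-inj {suc i} {suc j} e = cong suc (f-inj e)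

injective-avoiding⇒≤ : ∀ {m k} (f : Fin m → Fin (suc k)) (a : Fin (suc k)) →
  Injective _≡_ _≡_ f → (∀ i → f i ≢ a) → m ≤ k
injective-avoiding⇒≤ f a f-inj f≢a = FP.injective⇒≤ {f = λ i → F.punchOut (f≢a i ∘ sym)}
  (λ {i} {j} e → f-inj (FP.punchOut-injective (f≢a i ∘ sym) (f≢a j ∘ sym) e))

injective-avoiding₂⇒< : ∀ {m k} (f : Fin m → Fin (suc k)) (a b : Fin (suc k)) → a ≢ b →
  Injective _≡_ _≡_ f → (∀ i → f i ≢ a) → (∀ i → f i ≢ b) → suc m ≤ k
injective-avoiding₂⇒< {k = zero} f zero zero a≢b _ _ _ = ⊥-elim (a≢b refl)
injective-avoiding₂⇒< {m} {suc k} f a b a≢b f-inj f≢a f≢b =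
  s≤s (injective-avoiding⇒≤ g (F.punchOut a≢b) g-inj g≢b)
  where
  g : Fin m → Fin (suc k)
  g i = F.punchOut (f≢a i ∘ sym)
  g-inj : Injective _≡_ _≡_ g
  g-inj {i} {j} e = f-inj (FP.punchOut-injective (f≢a i ∘ sym) (f≢a j ∘ sym) e)
  g≢b : ∀ i → g i ≢ F.punchOut a≢b
  g≢b i e = f≢b i (FP.punchOut-injective (f≢a i ∘ sym) a≢b e)

pick-other : ℕ → List ℕ → ℕ
pick-other x [] = 0
pick-other x (y ∷ ys) with y ℕP.≟ x
... | yes _ = pick-other x ys
... | no _ = y

pick-other-spec : ∀ x L → Unique L → 2 ≤ length L → pick-other x L ∈ L × pick-other x L ≢ x
pick-other-spec x (y ∷ []) _ (s≤s ())
pick-other-spec x (y ∷ z ∷ zs) (y∉ ∷ u) _ with y ℕP.≟ x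
... | no y≢x = here refl , y≢x
... | yes refl with z ℕP.≟ y
...   | yes refl = ⊥-elim (All.lookup y∉ (here refl) refl)
...   | no z≢y = there (here refl) , z≢y

pick-avoiding : Maybe ℕ → List ℕ → ℕ
pick-avoiding nothing [] = 0
pick-avoiding nothing (y ∷ ys) = y
pick-avoiding (just x) L = pick-other x L

pick-avoiding-∈ : ∀ m L → Unique L → 2 ≤ length L → pick-avoiding m L ∈ L
pick-avoiding-∈ nothing (y ∷ ys) _ _ = here refl
pick-avoiding-∈ (just x) L u |L| = proj₁ (pick-other-spec x L u |L|)

-- the least t ≤ b with P t, or b if there is none
least : (ℕ → Bool) → ℕ → ℕ
least P zero = zero
least P (suc b) = if P zero then zero else suc (least (λ t → P (suc t)) b)

least-satisfies : ∀ (P : ℕ → Bool) b t → t ≤ b → P t ≡ true → P (least P b) ≡ true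
least-satisfies P zero .zero z≤n p = p
least-satisfies P (suc b) t t≤b p with P zero in eq
least-satisfies P (suc b) t t≤b p | true = eq
least-satisfies P (suc b) zero t≤b p | false with () ← trans (sym p) eq
least-satisfies P (suc b) (suc t) (s≤s t≤b) p | false = least-satisfies (λ t → P (suc t)) b t t≤b p

least-minimal : ∀ (P : ℕ → Bool) b t → P t ≡ true → least P b ≤ t
least-minimal P zero t p = z≤n
least-minimal P (suc b) t p with P zero in eq
least-minimal P (suc b) t p | true = z≤n
least-minimal P (suc b) zero p | false with () ← trans (sym p) eq
least-minimal P (suc b) (suc t) p | false = s≤s (least-minimal (λ t → P (suc t)) b t p)

<least⇒false : ∀ (P : ℕ → Bool) b t → t < least P b → P t ≡ false
<least⇒false P (suc b) t lt with P zero in eq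
<least⇒false P (suc b) t () | true
<least⇒false P (suc b) zero lt | false = eq
<least⇒false P (suc b) (suc t) (s≤s lt) | false = <least⇒false (λ t → P (suc t)) b t lt

first-index : ∀ {m} (P : Fin m → Bool) →
  (Σ (Fin m) λ i → P i ≡ true × (∀ j → j F.< i → P j ≡ false)) ⊎ (∀ i → P i ≡ false)
first-index {zero} P = inj₂ λ ()
first-index {suc m} P with P zero in eq
... | true = inj₁ (zero , eq , λ j ())
... | false with first-index (λ i → P (suc i))
...   | inj₂ none = inj₂ λ { zero → eq ; (suc i) → none i }
...   | inj₁ (i , Pi , before) = inj₁ (suc i , Pi , λ { zero _ → eq ; (suc j) (s≤s lt) → before j lt })

-- Trees

module TreeFacts (T : Tree) where
  open Tree T

  _≟_ : DecidableEquality (Fin n)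
  _≟_ = FP._≟_

  Adj : Fin n → Fin n → Set
  Adj u v = adj u v ≡ true

  Adj⇒≢ : ∀ {u v} → Adj u v → u ≢ v
  Adj⇒≢ {u} uv refl with () ← trans (sym uv) (adj-irr u)

  Adj-sym : ∀ {u v} → Adj u v → Adj v u
  Adj-sym {u} {v} uv = trans (adj-sym v u) uv

  ends : Edge → Fin n × Fin n
  ends = proj₁

  Edge-ext : (e e′ : Edge) → ends e ≡ ends e′ → e ≡ e′
  Edge-ext (p , l , a) (.p , l′ , a′) refl
    rewrite FP.<-irrelevant l l′ | Bool-UIP a a′ = refl

  _≟ₑ_ : DecidableEquality Edge
  e ≟ₑ e′ with proj₁ (ends e) ≟ proj₁ (ends e′) | proj₂ (ends e) ≟ proj₂ (ends e′)
  ... | yes p | yes q = yes (Edge-ext e e′ (cong₂ _,_ p q))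
  ... | no ¬p | _ = no λ eq → ¬p (cong (proj₁ ∘ ends) eq)
  ... | _ | no ¬q = no λ eq → ¬q (cong (proj₂ ∘ ends) eq)

  edge : (u v : Fin n) → Adj u v → Edge
  edge u v uv with FP.<-cmp u v
  ... | tri< u<v _ _ = (u , v) , u<v , uv
  ... | tri≈ _ u≡v _ = ⊥-elim (Adj⇒≢ uv u≡v)
  ... | tri> _ _ v<u = (v , u) , v<u , Adj-sym uv

  edge-ends : ∀ u v uv → ends (edge u v uv) ≡ (u , v) ⊎ ends (edge u v uv) ≡ (v , u)
  edge-ends u v uv with FP.<-cmp u v
  ... | tri< _ _ _ = inj₁ refl
  ... | tri≈ _ u≡v _ = ⊥-elim (Adj⇒≢ uv u≡v)
  ... | tri> _ _ _ = inj₂ refl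

  edge-η : (e : Edge) → e ≡ edge (proj₁ (ends e)) (proj₂ (ends e)) (proj₂ (proj₂ e))
  edge-η ((u , v) , u<v , uv) with FP.<-cmp u v
  ... | tri< _ _ _ = Edge-ext _ _ refl
  ... | tri≈ _ u≡v _ = ⊥-elim (Adj⇒≢ uv u≡v)
  ... | tri> _ _ v<u = ⊥-elim (FP.<-asym u<v v<u)

  edge-sym : ∀ u v uv vu → edge u v uv ≡ edge v u vu
  edge-sym u v uv vu with FP.<-cmp u v | FP.<-cmp v u
  ... | tri< l _ _ | tri< l′ _ _ = ⊥-elim (FP.<-asym l l′)
  ... | tri< _ _ _ | tri≈ _ eq _ = ⊥-elim (Adj⇒≢ vu eq)
  ... | tri< _ _ _ | tri> _ _ _ = Edge-ext _ _ refl
  ... | tri≈ _ eq _ | _ = ⊥-elim (Adj⇒≢ uv eq)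
  ... | tri> _ _ _ | tri< _ _ _ = Edge-ext _ _ refl
  ... | tri> _ _ _ | tri≈ _ eq _ = ⊥-elim (Adj⇒≢ vu eq)
  ... | tri> _ _ g | tri> _ _ g′ = ⊥-elim (FP.<-asym g g′)

  edge-irrelevant : ∀ u v uv uv′ → edge u v uv ≡ edge u v uv′
  edge-irrelevant u v uv uv′ rewrite Bool-UIP uv uv′ = refl

  Incident-edgeˡ : ∀ u v uv → Incident u (edge u v uv)
  Incident-edgeˡ u v uv with edge-ends u v uv
  ... | inj₁ eq = inj₁ (sym (cong proj₁ eq))
  ... | inj₂ eq = inj₂ (sym (cong proj₂ eq))

  Incident-edgeʳ : ∀ u v uv → Incident v (edge u v uv)
  Incident-edgeʳ u v uv with edge-ends u v uv
  ... | inj₁ eq = inj₂ (sym (cong proj₂ eq))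
  ... | inj₂ eq = inj₁ (sym (cong proj₁ eq))

  Incident-edge⁻ : ∀ {x u v uv} → Incident x (edge u v uv) → x ≡ u ⊎ x ≡ v
  Incident-edge⁻ {u = u} {v} {uv} i with edge-ends u v uv | i
  ... | inj₁ eq | inj₁ p = inj₁ (trans p (cong proj₁ eq))
  ... | inj₁ eq | inj₂ p = inj₂ (trans p (cong proj₂ eq))
  ... | inj₂ eq | inj₁ p = inj₂ (trans p (cong proj₁ eq))
  ... | inj₂ eq | inj₂ p = inj₁ (trans p (cong proj₂ eq))

  Incident⇒edge : ∀ {u} (e : Edge) → Incident u e → Σ (Fin n) λ v → Σ (Adj u v) λ uv → e ≡ edge u v uv
  Incident⇒edge ((x , y) , _ , xy) (inj₁ refl) = y , xy , edge-η _
  Incident⇒edge ((x , y) , _ , xy) (inj₂ refl) = x , Adj-sym xy , trans (edge-η _) (edge-sym x y xy (Adj-sym xy))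

  edge-injective : ∀ {v w w′ vw vw′} → edge v w vw ≡ edge v w′ vw′ → w ≡ w′
  edge-injective {v} {w} {w′} {vw} {vw′} eq
    with Incident-edge⁻ {uv = vw′} (subst (Incident w) eq (Incident-edgeʳ v w vw))
  ... | inj₁ w≡v = ⊥-elim (Adj⇒≢ vw (sym w≡v))
  ... | inj₂ w≡w′ = w≡w′

  -- junk unless v is an end of e
  other : Fin n → Edge → Fin n
  other v e = if does (v ≟ proj₁ (ends e)) then proj₂ (ends e) else proj₁ (ends e)

  other-edge : ∀ v w vw → other v (edge v w vw) ≡ w
  other-edge v w vw with edge-ends v w vw
  ... | inj₁ eq rewrite eq with v ≟ v
  ...   | yes _ = refl
  ...   | no v≢v = ⊥-elim (v≢v refl)
  other-edge v w vw | inj₂ eq rewrite eq with v ≟ w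
  ...   | yes v≡w = ⊥-elim (Adj⇒≢ vw v≡w)
  ...   | no _ = refl

  no-triangle : ∀ {a b c} → Adj a b → Adj b c → Adj c a → ⊥
  no-triangle {a} {b} {c} ab bc ca = acyclic 0 f (f-injective , f-steps , ca)
    where
    f : Fin 3 → Fin n
    f zero = a
    f (suc zero) = b
    f (suc (suc zero)) = c
    f-injective : Injective _≡_ _≡_ f
    f-injective {zero} {zero} e = refl
    f-injective {zero} {suc zero} e = ⊥-elim (Adj⇒≢ ab e)
    f-injective {zero} {suc (suc zero)} e = ⊥-elim (Adj⇒≢ ca (sym e))
    f-injective {suc zero} {zero} e = ⊥-elim (Adj⇒≢ ab (sym e))
    f-injective {suc zero} {suc zero} e = refl
    f-injective {suc zero} {suc (suc zero)} e = ⊥-elim (Adj⇒≢ bc e)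
    f-injective {suc (suc zero)} {zero} e = ⊥-elim (Adj⇒≢ ca e)
    f-injective {suc (suc zero)} {suc zero} e = ⊥-elim (Adj⇒≢ bc (sym e))
    f-injective {suc (suc zero)} {suc (suc zero)} e = refl
    f-steps : ∀ (i : Fin 2) → adj (f (inject₁ i)) (f (suc i)) ≡ true
    f-steps zero = ab
    f-steps (suc zero) = bc

  no-cycle : ∀ x y z rest → Unique (x ∷ y ∷ z ∷ rest) → Linked Adj (x ∷ y ∷ z ∷ rest) →
    Adj (lastOf z rest) x → ⊥
  no-cycle x y z rest u l closing =
    acyclic (length rest) (lookup (x ∷ y ∷ z ∷ rest))
      (lookup-injective u , Linked-lookup l ,
       subst (λ t → adj t x ≡ true) (sym (lookup-last x (y ∷ z ∷ rest))) closing)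

  AdjAvoiding : Fin n → Fin n → Fin n → Fin n → Set
  AdjAvoiding u w a b = Adj a b × ¬ (a ≡ u × b ≡ w) × ¬ (a ≡ w × b ≡ u)

  no-detour : ∀ {u w} → Adj u w → (xs : List (Fin n)) → Linked (AdjAvoiding u w) (u ∷ xs) →
    lastOf u xs ≢ w
  no-detour {u} {w} uw xs l last≡w with erase-loops _≟_ u xs l
  ... | [] , _ , _ , last≡ = Adj⇒≢ uw (trans last≡ last≡w)
  ... | y ∷ [] , (r ∷ [-]) , _ , last≡ = proj₁ (proj₂ r) (refl , trans last≡ last≡w)
  ... | y ∷ z ∷ rest , l′ , u′ , last≡ =
    no-cycle u y z rest u′ (Linked.map proj₁ l′)
      (subst (λ t → Adj t u) (sym (trans last≡ last≡w)) (Adj-sym uw))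

  -- The vertices of such a walk never repeat, since a first repetition
  -- s (1 + t) = s i would make s i … s t a detour around the edge s t — s i;
  -- this is absurd as there are only n vertices.
  module NonBacktracking (s : ℕ → Fin n) (s-adj : ∀ i → Adj (s i) (s (suc i)))
                         (s-nb : ∀ i → s (suc (suc i)) ≢ s i) where

    Distinct : ℕ → Set
    Distinct t = ∀ a b → a ≤ t → b ≤ t → s a ≡ s b → a ≡ b

    segment : ℕ → ℕ → List (Fin n)
    segment i zero = []
    segment i (suc m) = s (suc i) ∷ segment (suc i) m

    segment-Linked : ∀ {R : Fin n → Fin n → Set} i m →
      (∀ a → i ≤ a → a < i + m → R (s a) (s (suc a))) → Linked R (s i ∷ segment i m)
    segment-Linked i zero h = [-]
    segment-Linked i (suc m) h =
      h i ℕP.≤-refl (subst (i <_) (sym (ℕP.+-suc i m)) (s≤s (ℕP.m≤m+n i m)))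
      ∷ segment-Linked (suc i) m (λ a i<a lt → h a (ℕP.<⇒≤ i<a) (subst (a <_) (sym (ℕP.+-suc i m)) lt))

    segment-last : ∀ i m → lastOf (s i) (segment i m) ≡ s (i + m)
    segment-last i zero = cong s (sym (ℕP.+-identityʳ i))
    segment-last i (suc m) = trans (segment-last (suc i) m) (cong s (sym (ℕP.+-suc i m)))

    no-return : ∀ i m → Distinct (i + m) → s (suc (i + m)) ≢ s i
    no-return i zero _ eq = Adj⇒≢ (s-adj (i + 0)) (sym (trans eq (cong s (sym (ℕP.+-identityʳ i)))))
    no-return i (suc zero) _ eq = s-nb i (trans (cong (λ t → s (suc t)) (sym (ℕP.+-comm i 1))) eq)
    no-return i (suc (suc m)) distinct eq =
      no-detour closing (segment i M) (segment-Linked i M avoiding) (segment-last i M)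
      where
      M : ℕ
      M = suc (suc m)
      closing : Adj (s i) (s (i + M))
      closing = subst (λ t → Adj t (s (i + M))) eq (Adj-sym (s-adj (i + M)))
      avoiding : ∀ a → i ≤ a → a < i + M → AdjAvoiding (s i) (s (i + M)) (s a) (s (suc a))
      avoiding a i≤a a<i+M = s-adj a , forward , backward
        where
        forward : ¬ (s a ≡ s i × s (suc a) ≡ s (i + M))
        forward (e₁ , e₂) with distinct a i (ℕP.<⇒≤ a<i+M) (ℕP.m≤m+n i M) e₁
                              | distinct (suc a) (i + M) a<i+M ℕP.≤-refl e₂
        ... | refl | e₃ = ℕP.m≢1+m+n i (ℕP.suc-injective
                            (trans e₃ (trans (ℕP.+-suc i (suc m)) (cong suc (ℕP.+-suc i m)))))
        backward : ¬ (s a ≡ s (i + M) × s (suc a) ≡ s i)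
        backward (e₁ , _) with distinct a (i + M) (ℕP.<⇒≤ a<i+M) ℕP.≤-refl e₁
        ... | refl = ℕP.<-irrefl refl a<i+M

    no-return-≤ : ∀ t → Distinct t → ∀ i → i ≤ t → s (suc t) ≢ s i
    no-return-≤ t distinct i i≤t = subst (λ x → s (suc x) ≢ s i) (ℕP.m+[n∸m]≡n i≤t)
      (no-return i (t ∸ i) (subst Distinct (sym (ℕP.m+[n∸m]≡n i≤t)) distinct))

    distinct : ∀ t → Distinct t
    distinct zero a b z≤n z≤n _ = refl
    distinct (suc t) a b a≤ b≤ e with ℕP.m≤n⇒m<n∨m≡n a≤ | ℕP.m≤n⇒m<n∨m≡n b≤
    ... | inj₁ a<  | inj₁ b<  = distinct t a b (ℕP.≤-pred a<) (ℕP.≤-pred b<) e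
    ... | inj₂ refl | inj₂ refl = refl
    ... | inj₁ a<  | inj₂ refl = ⊥-elim (no-return-≤ t (distinct t) a (ℕP.≤-pred a<) (sym e))
    ... | inj₂ refl | inj₁ b<  = ⊥-elim (no-return-≤ t (distinct t) b (ℕP.≤-pred b<) e)

    absurd : ⊥
    absurd = ℕP.<-irrefl refl (FP.injective⇒≤ {f = λ (i : Fin (suc n)) → s (toℕ i)}
      (λ {i} {j} e → FP.toℕ-injective (distinct n (toℕ i) (toℕ j)
         (ℕP.≤-pred (FP.toℕ<n i)) (ℕP.≤-pred (FP.toℕ<n j)) e)))

  no-non-backtracking-walk : (s : ℕ → Fin n) → (∀ i → Adj (s i) (s (suc i))) →
    (∀ i → s (suc (suc i)) ≢ s i) → ⊥
  no-non-backtracking-walk = NonBacktracking.absurd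

  walk-start : ∀ {S u v} → WalkIn adj S u v → S u ≡ true
  walk-start (here p) = p
  walk-start (step p _ _) = p

  walk-mono : ∀ {S S′} → (∀ x → S x ≡ true → S′ x ≡ true) → ∀ {u v} → WalkIn adj S u v → WalkIn adj S′ u v
  walk-mono S⊆S′ (here p) = here (S⊆S′ _ p)
  walk-mono S⊆S′ (step p a w) = step (S⊆S′ _ p) a (walk-mono S⊆S′ w)

  walk-snoc : ∀ {S u v w} → WalkIn adj S u v → S w ≡ true → Adj v w → WalkIn adj S u w
  walk-snoc (here p) q vw = step p vw (here q)
  walk-snoc (step p a w) q vw = step p a (walk-snoc w q vw)

  walk-++ : ∀ {S u v w} → WalkIn adj S u v → WalkIn adj S v w → WalkIn adj S u w
  walk-++ (here _) w = w
  walk-++ (step p a w₁) w₂ = step p a (walk-++ w₁ w₂)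

  walk-reverse : ∀ {S u v} → WalkIn adj S u v → WalkIn adj S v u
  walk-reverse (here p) = here p
  walk-reverse (step p a w) = walk-snoc (walk-reverse w) p (Adj-sym a)

  AdjIn : (Fin n → Bool) → Fin n → Fin n → Set
  AdjIn S a b = Adj a b × S a ≡ true × S b ≡ true

  walk⇒Linked : ∀ {S u v} → WalkIn adj S u v →
    Σ (List (Fin n)) λ xs → Linked (AdjIn S) (u ∷ xs) × lastOf u xs ≡ v
  walk⇒Linked (here p) = [] , [-] , refl
  walk⇒Linked (step {w = w} p a rest) with walk⇒Linked rest
  ... | xs , l , last≡ = w ∷ xs , (a , p , walk-start rest) ∷ l , last≡

  first-step : ∀ {x y} → WalkIn adj (λ _ → true) x y → x ≢ y → Σ (Fin n) (Adj x)
  first-step (here _) x≢y = ⊥-elim (x≢y refl)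
  first-step (step _ a _) _ = _ , a

  two-vertices : 2 ≤ n → Σ (Fin n) λ v₀ → Σ (Fin n) λ v₁ → v₀ ≢ v₁
  two-vertices 2≤n = F.fromℕ< {0} (ℕP.<-≤-trans (s≤s z≤n) 2≤n) , F.fromℕ< {1} 2≤n , λ e →
    0≢1 (trans (sym (FP.toℕ-fromℕ< _)) (trans (cong toℕ e) (FP.toℕ-fromℕ< 2≤n)))
    where 0≢1 : 0 ≢ 1
          0≢1 ()

  has-neighbour : 2 ≤ n → ∀ v → Σ (Fin n) (Adj v)
  has-neighbour 2≤n v with two-vertices 2≤n
  ... | v₀ , v₁ , v₀≢v₁ with v ≟ v₀
  ...   | yes refl = first-step (connected v v₁) v₀≢v₁
  ...   | no v≢v₀ = first-step (connected v v₀) v≢v₀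

  module Reach (E : Fin n → Fin n → Set) (E? : ∀ u v → Dec (E u v)) (X : Fin n → Bool) where

    reach : ℕ → Fin n → Bool
    reach zero u = X u
    reach (suc t) u = reach t u ∨ does (FP.any? λ x → E? u x ×-dec (reach t x Bool.≟ true))

    reach-suc⁻ : ∀ t u → reach (suc t) u ≡ true → reach t u ≡ true ⊎ Σ (Fin n) λ x → E u x × reach t x ≡ true
    reach-suc⁻ t u p with ∨-true⁻ (reach t u) _ p
    ... | inj₁ q = inj₁ q
    ... | inj₂ q = inj₂ (dec-true⁻ (FP.any? _) q)

    reach-step : ∀ t u x → E u x → reach t x ≡ true → reach (suc t) u ≡ true
    reach-step t u x ux p = ∨-trueʳ (reach t u) (dec-true (FP.any? _) (x , ux , p))

    reach-mono′ : ∀ {t t′} u → t ℕ.≤′ t′ → reach t u ≡ true → reach t′ u ≡ true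
    reach-mono′ u ℕ.≤′-refl p = p
    reach-mono′ u (ℕ.≤′-step t≤′t′) p = ∨-trueˡ _ (reach-mono′ u t≤′t′ p)

    reach-mono : ∀ t t′ u → t ≤ t′ → reach t u ≡ true → reach t′ u ≡ true
    reach-mono t t′ u t≤t′ = reach-mono′ u (ℕP.≤⇒≤′ t≤t′)

    reach-sound : ∀ t u → reach t u ≡ true → Σ (List (Fin n)) λ xs → Linked E (u ∷ xs) × X (lastOf u xs) ≡ true
    reach-sound zero u p = [] , [-] , p
    reach-sound (suc t) u p with reach-suc⁻ t u p
    ... | inj₁ q = reach-sound t u q
    ... | inj₂ (x , ux , q) with reach-sound t x q
    ...   | xs , l , last∈X = x ∷ xs , ux ∷ l , last∈X

    reach-complete : ∀ u xs → Linked E (u ∷ xs) → X (lastOf u xs) ≡ true → reach (length xs) u ≡ true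
    reach-complete u [] l p = p
    reach-complete u (y ∷ ys) (uy ∷ l) p = reach-step (length ys) u y uy (reach-complete y ys l p)

    -- loop erasure bounds the number of steps by n
    reach-within-n : ∀ u xs → Linked E (u ∷ xs) → X (lastOf u xs) ≡ true → reach n u ≡ true
    reach-within-n u xs l p with erase-loops _≟_ u xs l
    ... | zs , l′ , u′ , last≡ = reach-mono (length zs) n u (ℕP.<⇒≤ (Unique-length≤ u′))
        (reach-complete u zs l′ (subst (λ t → X t ≡ true) (sym last≡) p))

-- The graph G(T,K)

module NetblockGraph (N : Netblock) where
  open Netblock N
  open TreeFacts T public

  G : Graph
  G = G[ N ]

  V : Set
  V = GV N

  _~_ : V → V → Set
  _~_ = GAdj N

  _≟ᵥ_ : DecidableEquality V
  _≟ᵥ_ = ⊎P.≡-dec _≟_ (ΣP.≡-dec _≟ₑ_ FP._≟_)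

  open DecSubsets _≟ᵥ_ public

  ~-sym : ∀ {x y} → x ~ y → y ~ x
  ~-sym {inj₁ u} {inj₁ v} a = Adj-sym a
  ~-sym {inj₁ u} {inj₂ q} a = a
  ~-sym {inj₂ p} {inj₁ v} a = a
  ~-sym {inj₂ p} {inj₂ q} (e , p≢q) = sym e , p≢q ∘ sym

  ~-irrefl : ∀ {x} → ¬ (x ~ x)
  ~-irrefl {inj₁ u} a = Adj⇒≢ a refl
  ~-irrefl {inj₂ p} (_ , p≢p) = p≢p refl

  block-subst : ∀ {e e′} → e ≡ e′ → (i : Fin (K e)) →
    Σ (Fin (K e′)) λ i′ → _≡_ {A = V} (inj₂ (e , i)) (inj₂ (e′ , i′))
  block-subst refl i = i , refl

  -- The neighbourhood of a tree vertex v splits into branches, one for each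
  -- neighbour w of v in T: the vertex w and the clique B(vw).
  data Branch (v w : Fin n) (vw : Adj v w) : V → Set where
    end   : Branch v w vw (inj₁ w)
    block : ∀ i → Branch v w vw (inj₂ (edge v w vw , i))

  neighbour-branch : ∀ v z → inj₁ v ~ z → Σ (Fin n) λ w → Σ (Adj v w) λ vw → Branch v w vw z
  neighbour-branch v (inj₁ u) vu = u , vu , end
  neighbour-branch v (inj₂ (e , i)) v∈e with Incident⇒edge e v∈e
  ... | w , vw , refl = w , vw , block i

  Branch⇒neighbour : ∀ {v w vw z} → Branch v w vw z → inj₁ v ~ z
  Branch⇒neighbour {vw = vw} end = vw
  Branch⇒neighbour {v} {w} {vw} (block i) = Incident-edgeˡ v w vw

  Branch⇒≢ : ∀ {v w vw z} → Branch v w vw z → z ≢ inj₁ v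
  Branch⇒≢ {vw = vw} end e = Adj⇒≢ vw (sym (inj₁-injective e))
  Branch⇒≢ (block i) ()

  Branch-clique : ∀ {v w vw z z′} → Branch v w vw z → Branch v w vw z′ → z ≢ z′ → z ~ z′
  Branch-clique end end z≢z′ = ⊥-elim (z≢z′ refl)
  Branch-clique {v} {w} {vw} end (block i) _ = Incident-edgeʳ v w vw
  Branch-clique {v} {w} {vw} (block i) end _ = Incident-edgeʳ v w vw
  Branch-clique (block i) (block j) z≢z′ = refl , λ e → z≢z′ (cong inj₂ e)

  branches-independent : ∀ {v w w′ vw vw′ z z′} → Branch v w vw z → Branch v w′ vw′ z′ → w ≢ w′ →
    ¬ (z ~ z′)
  branches-independent {vw = vw} {vw′} end end _ ww′ = no-triangle vw ww′ (Adj-sym vw′)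
  branches-independent {vw = vw} {vw′} end (block i) w≢w′ w∈e with Incident-edge⁻ {uv = vw′} w∈e
  ... | inj₁ w≡v = Adj⇒≢ vw (sym w≡v)
  ... | inj₂ w≡w′ = w≢w′ w≡w′
  branches-independent {vw = vw} {vw′} (block i) end w≢w′ w′∈e with Incident-edge⁻ {uv = vw} w′∈e
  ... | inj₁ w′≡v = Adj⇒≢ vw′ (sym w′≡v)
  ... | inj₂ w′≡w = w≢w′ (sym w′≡w)
  branches-independent {vw = vw} {vw′} (block i) (block j) w≢w′ (e≡e′ , _) =
    w≢w′ (edge-injective {vw = vw} {vw′} e≡e′)

  branch-end : Fin n → V → Fin n
  branch-end v (inj₁ u) = u
  branch-end v (inj₂ (e , _)) = other v e

  branch-end-Branch : ∀ {v w vw z} → Branch v w vw z → branch-end v z ≡ w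
  branch-end-Branch end = refl
  branch-end-Branch {v} {w} {vw} (block i) = other-edge v w vw

  Branch-unique : ∀ {v w w′ vw vw′ z} → Branch v w vw z → Branch v w′ vw′ z → w ≡ w′
  Branch-unique b b′ = trans (sym (branch-end-Branch b)) (branch-end-Branch b′)

  insert-proper : ∀ {S w} → S w ≡ false → ProperlyContained G S (insert w S)
  insert-proper {S} {w} w∉S = (λ x → ∈-insert-old w S) , w , ∈-insert-new w S , w∉S

  insert-leaf : ∀ {S} (st : IsStar G S) w → proj₁ st ~ w →
    (∀ x → S x ≡ true → x ≢ proj₁ st → ¬ (x ~ w)) → IsStar G (insert w S)
  insert-leaf {S} (c , c∈S , (l , l∈S , l≢c) , c~ , indep) w c~w leaves≁w =
    c , ∈-insert-old w S c∈S , (l , ∈-insert-old w S l∈S , l≢c) , c~′ , indep′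
    where
    c~′ : ∀ x → insert w S x ≡ true → x ≢ c → c ~ x
    c~′ x x∈ x≢c with ∈-insert⁻ w S x x∈
    ... | inj₁ x∈S = c~ x x∈S x≢c
    ... | inj₂ refl = c~w
    indep′ : ∀ x y → insert w S x ≡ true → insert w S y ≡ true → x ≢ c → y ≢ c → ¬ (x ~ y)
    indep′ x y x∈ y∈ x≢c y≢c with ∈-insert⁻ w S x x∈ | ∈-insert⁻ w S y y∈
    ... | inj₁ x∈S | inj₁ y∈S = indep x y x∈S y∈S x≢c y≢c
    ... | inj₁ x∈S | inj₂ refl = leaves≁w x x∈S x≢c
    ... | inj₂ refl | inj₁ y∈S = leaves≁w y y∈S y≢c ∘ ~-sym
    ... | inj₂ refl | inj₂ refl = ~-irrefl

  maximal-star-absorbs : ∀ {S} (st : IsStar G S) → (∀ S′ → IsStar G S′ → ¬ ProperlyContained G S S′) →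
    ∀ w → proj₁ st ~ w → (∀ x → S x ≡ true → x ≢ proj₁ st → ¬ (x ~ w)) → S w ≡ true
  maximal-star-absorbs {S} st maximal w c~w leaves≁w with S w in w∈S
  ... | true = refl
  ... | false = ⊥-elim (maximal _ (insert-leaf st w c~w leaves≁w) (insert-proper w∈S))

  pair : V → V → V → Bool
  pair x y = insert y ｛ x ｝

  ∈-pair⁻ : ∀ {x y z} → pair x y z ≡ true → z ≡ x ⊎ z ≡ y
  ∈-pair⁻ {x} {y} {z} z∈ with ∈-insert⁻ y ｛ x ｝ z z∈
  ... | inj₁ z∈x = inj₁ (∈-｛｝⁻ z∈x)
  ... | inj₂ z≡y = inj₂ z≡y

  x∈pair : ∀ x y → pair x y x ≡ true
  x∈pair x y = ∈-insert-old y ｛ x ｝ {x} (∈-｛｝ x)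

  y∈pair : ∀ x y → pair x y y ≡ true
  y∈pair x y = ∈-insert-new y ｛ x ｝

  twin-edge-maximal : ∀ {x y} → x ~ y → (∀ z → z ~ x → z ≢ y → z ~ y) → (∀ z → z ~ y → z ≢ x → z ~ x) →
    IsMaximalStar G (pair x y)
  twin-edge-maximal {x} {y} xy x⊆y y⊆x = star , maximal
    where
    y≢x : y ≢ x
    y≢x refl = ~-irrefl xy
    star : IsStar G (pair x y)
    star = x , x∈pair x y , (y , y∈pair x y , y≢x) , x~ , indep
      where
      x~ : ∀ z → pair x y z ≡ true → z ≢ x → x ~ z
      x~ z z∈ z≢x with ∈-pair⁻ z∈
      ... | inj₁ z≡x = ⊥-elim (z≢x z≡x)
      ... | inj₂ refl = xy
      indep : ∀ z z′ → pair x y z ≡ true → pair x y z′ ≡ true → z ≢ x → z′ ≢ x → ¬ (z ~ z′)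
      indep z z′ z∈ z′∈ z≢x z′≢x with ∈-pair⁻ z∈ | ∈-pair⁻ z′∈
      ... | inj₁ z≡x | _ = ⊥-elim (z≢x z≡x)
      ... | _ | inj₁ z′≡x = ⊥-elim (z′≢x z′≡x)
      ... | inj₂ refl | inj₂ refl = ~-irrefl
    maximal : ∀ S′ → IsStar G S′ → ¬ ProperlyContained G (pair x y) S′
    maximal S′ (c , _ , _ , c~ , indep) (⊆S′ , z , z∈S′ , z∉) with c ≟ᵥ x | c ≟ᵥ y
    ... | yes refl | _ = indep z y z∈S′ (⊆S′ y (y∈pair x y)) z≢x y≢x (x⊆y z (~-sym (c~ z z∈S′ z≢x)) z≢y)
      where
      z≢x : z ≢ x
      z≢x refl with () ← trans (sym z∉) (x∈pair x y)
      z≢y : z ≢ y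
      z≢y refl with () ← trans (sym z∉) (y∈pair x y)
    ... | no _ | yes refl = indep z x z∈S′ (⊆S′ x (x∈pair x y)) z≢y (y≢x ∘ sym) (y⊆x z (~-sym (c~ z z∈S′ z≢y)) z≢x)
      where
      z≢x : z ≢ x
      z≢x refl with () ← trans (sym z∉) (x∈pair x y)
      z≢y : z ≢ y
      z≢y refl with () ← trans (sym z∉) (y∈pair x y)
    ... | no c≢x | no c≢y =
      indep x y (⊆S′ x (x∈pair x y)) (⊆S′ y (y∈pair x y)) (c≢x ∘ sym) (c≢y ∘ sym) xy

  twin-edge-monochromatic : ∀ {A : Set} (ρ : V → A) {x y} → ρ x ≡ ρ y → Monochromatic G ρ (pair x y)
  twin-edge-monochromatic ρ {x} {y} eq a b a∈ b∈ with ∈-pair⁻ {x} {y} {a} a∈ | ∈-pair⁻ {x} {y} {b} b∈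
  ... | inj₁ refl | inj₁ refl = refl
  ... | inj₁ refl | inj₂ refl = eq
  ... | inj₂ refl | inj₁ refl = sym eq
  ... | inj₂ refl | inj₂ refl = refl

  GoodNeighbour : {A : Set} → (V → A) → Fin n → Fin n → Set
  GoodNeighbour ρ v w = Σ (Adj v w) λ vw →
    ρ (inj₁ w) ≢ ρ (inj₁ v) × (∀ i → ρ (inj₂ (edge v w vw , i)) ≢ ρ (inj₁ v))

  RainbowBlocks : {A : Set} → (V → A) → Set
  RainbowBlocks ρ = ∀ e i j → i ≢ j → ρ (inj₂ (e , i)) ≢ ρ (inj₂ (e , j))

  -- A maximal star centred at a tree vertex v must meet the branch of a good
  -- neighbour of v; one centred in a block B(uv) with a leaf u is just that
  -- edge and must absorb a good neighbour of u.
  module StarColoringCriterion {A : Set} (ρ : V → A) (rainbow : RainbowBlocks ρ)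
                               (good : ∀ v → Σ (Fin n) (GoodNeighbour ρ v)) where

    centred-at-tree-vertex : ∀ {S} v → (st : IsStar G S) → proj₁ st ≡ inj₁ v →
      (∀ S′ → IsStar G S′ → ¬ ProperlyContained G S S′) → ¬ Monochromatic G ρ S
    centred-at-tree-vertex {S} v st@(_ , v∈S , _ , v~ , _) refl maximal mono
      with good v
    ... | w , vw , w≠ , block≠
      with FP.any? (λ i → S (inj₂ (edge v w vw , i)) Bool.≟ true)
    ...   | yes (i , i∈S) = block≠ i (mono _ _ i∈S v∈S)
    ...   | no block∉S = w≠ (mono _ _ (maximal-star-absorbs st maximal (inj₁ w) vw leaves≁w) v∈S)
      where
      leaves≁w : ∀ x → S x ≡ true → x ≢ inj₁ v → ¬ (x ~ inj₁ w)
      leaves≁w x x∈S x≢v with neighbour-branch v x (v~ x x∈S x≢v)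
      ... | w′ , vw′ , b with w′ ≟ w
      ...   | no w′≢w = branches-independent b (end {vw = vw}) w′≢w
      ...   | yes refl with Bool-UIP vw′ vw | b
      ...     | refl | end = ~-irrefl
      ...     | refl | block i = ⊥-elim (block∉S (i , x∈S))

    centred-at-block-vertex : ∀ {S} e i u → (st : IsStar G S) → proj₁ st ≡ inj₂ (e , i) →
      S (inj₁ u) ≡ true → (∀ S′ → IsStar G S′ → ¬ ProperlyContained G S S′) → ¬ Monochromatic G ρ S
    centred-at-block-vertex {S} e i u (_ , c∈S , _ , c~ , indep) refl u∈S maximal mono
      with Incident⇒edge e (c~ (inj₁ u) u∈S λ ())
    ... | v , uv , refl with good u
    ...   | w , uw , w≠ , block≠ with w ≟ v
    ...     | yes refl = let (i′ , c≡) = block-subst (edge-irrelevant u w uv uw) i in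
                         block≠ i′ (trans (cong ρ (sym c≡)) (mono _ _ c∈S u∈S))
    ...     | no w≢v = ∈-S⁻ (inj₁ w) (maximal-star-absorbs star-at-u maximal (inj₁ w) uw c≁w) λ
                         { (inj₁ ()) ; (inj₂ w≡u) → Adj⇒≢ uw (sym (inj₁-injective w≡u)) }
      where
      c : V
      c = inj₂ (edge u v uv , i)
      c~⇒u~ : ∀ x → c ~ x → x ≢ inj₁ u → x ~ inj₁ u
      c~⇒u~ (inj₁ u′) c~u′ u′≢u with Incident-edge⁻ {uv = uv} c~u′
      ... | inj₁ refl = ⊥-elim (u′≢u refl)
      ... | inj₂ refl = Adj-sym uv
      c~⇒u~ (inj₂ _) (refl , _) _ = Incident-edgeˡ u v uv
      ∈-S⁻ : ∀ x → S x ≡ true → ¬ ¬ (x ≡ c ⊎ x ≡ inj₁ u)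
      ∈-S⁻ x x∈S ¬c∪u with x ≟ᵥ c | x ≟ᵥ inj₁ u
      ... | yes x≡c | _ = ¬c∪u (inj₁ x≡c)
      ... | _ | yes x≡u = ¬c∪u (inj₂ x≡u)
      ... | no x≢c | no x≢u = indep x (inj₁ u) x∈S u∈S x≢c (λ ()) (c~⇒u~ x (c~ x x∈S x≢c) x≢u)
      leaf≡c : ∀ x → S x ≡ true → x ≢ inj₁ u → x ≡ c
      leaf≡c x x∈S x≢u with x ≟ᵥ c
      ... | yes x≡c = x≡c
      ... | no x≢c = ⊥-elim (∈-S⁻ x x∈S λ { (inj₁ x≡c) → x≢c x≡c ; (inj₂ x≡u) → x≢u x≡u })
      star-at-u : IsStar G S
      star-at-u = inj₁ u , u∈S , (c , c∈S , λ ()) , u~ , indep′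
        where
        u~ : ∀ x → S x ≡ true → x ≢ inj₁ u → inj₁ u ~ x
        u~ x x∈S x≢u rewrite leaf≡c x x∈S x≢u = Incident-edgeˡ u v uv
        indep′ : ∀ x y → S x ≡ true → S y ≡ true → x ≢ inj₁ u → y ≢ inj₁ u → ¬ (x ~ y)
        indep′ x y x∈S y∈S x≢u y≢u rewrite leaf≡c x x∈S x≢u | leaf≡c y y∈S y≢u = ~-irrefl
      c≁w : ∀ x → S x ≡ true → x ≢ inj₁ u → ¬ (x ~ inj₁ w)
      c≁w x x∈S x≢u c~w rewrite leaf≡c x x∈S x≢u with Incident-edge⁻ {uv = uv} c~w
      ... | inj₁ refl = Adj⇒≢ uw refl
      ... | inj₂ w≡v = w≢v w≡v

    is-star-coloring : IsStarColoring G ρ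
    is-star-coloring S ((inj₁ v , st) , maximal) = centred-at-tree-vertex v (inj₁ v , st) refl maximal
    is-star-coloring S ((inj₂ (e , i) , st@(_ , (inj₁ u , u∈S , _) , _)) , maximal) =
      centred-at-block-vertex e i u (inj₂ (e , i) , st) refl u∈S maximal
    is-star-coloring S ((inj₂ (e , i) , st@(c∈S , (inj₂ (e′ , j) , l∈S , l≢c) , c~ , _)) , maximal) mono
      with c~ _ l∈S l≢c
    ... | refl , eij≢ = rainbow e i j (λ i≡j → eij≢ (cong (e ,_) i≡j)) (mono _ _ c∈S l∈S)

  module StarColoringNecessary {A : Set} (ρ : V → A) (star : IsStarColoring G ρ)
                               (_≟ᴬ_ : DecidableEquality A) where

    twins-distinct : ∀ {x y} → x ~ y → (∀ z → z ~ x → z ≢ y → z ~ y) → (∀ z → z ~ y → z ≢ x → z ~ x) →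
      ρ x ≢ ρ y
    twins-distinct xy x⊆y y⊆x eq = star _ (twin-edge-maximal xy x⊆y y⊆x) (twin-edge-monochromatic ρ eq)

    rainbow : RainbowBlocks ρ
    rainbow e i j i≢j = twins-distinct (refl , λ { refl → i≢j refl }) (same-block i j) (same-block j i)
      where
      same-block : ∀ i j z → z ~ inj₂ (e , i) → z ≢ inj₂ (e , j) → z ~ inj₂ (e , j)
      same-block i j (inj₁ u) u∈e _ = u∈e
      same-block i j (inj₂ _) (e≡ , _) z≢ = e≡ , λ q → z≢ (cong inj₂ q)

    Leaf : Fin n → Fin n → Set
    Leaf v w = ∀ u → Adj v u → u ≡ w

    leaf-block-distinct : ∀ v w vw → Leaf v w → ∀ i → ρ (inj₂ (edge v w vw , i)) ≢ ρ (inj₁ v)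
    leaf-block-distinct v w vw leaf i = twins-distinct (Incident-edgeˡ v w vw) c⊆v v⊆c
      where
      c⊆v : ∀ z → z ~ inj₂ (edge v w vw , i) → z ≢ inj₁ v → z ~ inj₁ v
      c⊆v (inj₁ u) u∈e u≢v with Incident-edge⁻ {uv = vw} u∈e
      ... | inj₁ refl = ⊥-elim (u≢v refl)
      ... | inj₂ refl = Adj-sym vw
      c⊆v (inj₂ _) (refl , _) _ = Incident-edgeˡ v w vw
      v⊆c : ∀ z → z ~ inj₁ v → z ≢ inj₂ (edge v w vw , i) → z ~ inj₂ (edge v w vw , i)
      v⊆c z z~v z≢c with neighbour-branch v z (~-sym {z} z~v)
      ... | w′ , vw′ , b with leaf w′ vw′
      ...   | refl with Bool-UIP vw vw′
      ...     | refl = Branch-clique b (block i) z≢c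

    leaves-distinct : ∀ v w → Adj v w → Leaf v w → Leaf w v → ρ (inj₁ v) ≢ ρ (inj₁ w)
    leaves-distinct v w vw v-leaf w-leaf = twins-distinct vw (via v v-leaf) (via w w-leaf)
      where
      via : ∀ x {y} → Leaf x y → ∀ z → z ~ inj₁ x → z ≢ inj₁ y → z ~ inj₁ y
      via x leaf z z~x z≢y with neighbour-branch x z (~-sym {z} z~x)
      ... | y′ , xy′ , b with leaf y′ xy′
      ...   | refl = Branch-clique b end z≢y

    GoodNeighbour? : ∀ v w → Dec (GoodNeighbour ρ v w)
    GoodNeighbour? v w with adj v w Bool.≟ true
    ... | no ¬vw = no (¬vw ∘ proj₁)
    ... | yes vw with ρ (inj₁ w) ≟ᴬ ρ (inj₁ v)
    ...   | yes w= = no λ (_ , w≠ , _) → w≠ w=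
    ...   | no w≠ with FP.all? (λ i → ¬? (ρ (inj₂ (edge v w vw , i)) ≟ᴬ ρ (inj₁ v)))
    ...     | yes block≠ = yes (vw , w≠ , block≠)
    ...     | no ¬block≠ = no λ (vw′ , _ , block≠) → ¬block≠ (subst-block vw′ block≠)
      where
      subst-block : ∀ vw′ → (∀ i → ρ (inj₂ (edge v w vw′ , i)) ≢ ρ (inj₁ v)) →
        ∀ i → ρ (inj₂ (edge v w vw , i)) ≢ ρ (inj₁ v)
      subst-block vw′ block≠ rewrite Bool-UIP vw′ vw = block≠

    -- Without a good neighbour, v together with its neighbours of color ρ v
    -- (except block vertices of branches whose end has color ρ v) is a
    -- monochromatic star meeting every branch once; with two branches it is maximal.
    module WithoutGoodNeighbour (v w₁ w₂ : Fin n) (vw₁ : Adj v w₁) (vw₂ : Adj v w₂) (w₁≢w₂ : w₁ ≢ w₂)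
                                (no-good : ¬ ∃ (GoodNeighbour ρ v)) where

      ρv : A
      ρv = ρ (inj₁ v)

      InStar : V → Set
      InStar (inj₁ u) = u ≡ v ⊎ (Adj v u × ρ (inj₁ u) ≡ ρv)
      InStar (inj₂ (e , i)) = Incident v e × ρ (inj₂ (e , i)) ≡ ρv × ρ (inj₁ (other v e)) ≢ ρv

      InStar? : ∀ z → Dec (InStar z)
      InStar? (inj₁ u) = (u ≟ v) ⊎-dec ((adj v u Bool.≟ true) ×-dec (ρ (inj₁ u) ≟ᴬ ρv))
      InStar? (inj₂ (e , i)) = ((v ≟ proj₁ (ends e)) ⊎-dec (v ≟ proj₂ (ends e)))
        ×-dec (ρ (inj₂ (e , i)) ≟ᴬ ρv) ×-dec ¬? (ρ (inj₁ (other v e)) ≟ᴬ ρv)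

      Sv : V → Bool
      Sv z = does (InStar? z)

      InStar-color : ∀ z → InStar z → ρ z ≡ ρv
      InStar-color (inj₁ u) (inj₁ refl) = refl
      InStar-color (inj₁ u) (inj₂ (_ , eq)) = eq
      InStar-color (inj₂ _) (_ , eq , _) = eq

      InStar-neighbour : ∀ z → InStar z → z ≢ inj₁ v → inj₁ v ~ z
      InStar-neighbour (inj₁ u) (inj₁ refl) z≢v = ⊥-elim (z≢v refl)
      InStar-neighbour (inj₁ u) (inj₂ (vu , _)) _ = vu
      InStar-neighbour (inj₂ _) (v∈e , _) _ = v∈e

      representative : ∀ w vw → Σ V λ r → Branch v w vw r × InStar r
      representative w vw with ρ (inj₁ w) ≟ᴬ ρv
      ... | yes w= = inj₁ w , end , inj₂ (vw , w=)
      ... | no w≠ with FP.¬∀⟶∃¬ _ _ (λ i → ¬? (ρ (inj₂ (edge v w vw , i)) ≟ᴬ ρv))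
                         (λ block≠ → no-good (w , vw , w≠ , block≠))
      ...   | i , ¬≠ = inj₂ (edge v w vw , i) , block i ,
                       Incident-edgeˡ v w vw , decidable-stable (_ ≟ᴬ _) ¬≠ ,
                       subst (λ x → ρ (inj₁ x) ≢ ρv) (sym (other-edge v w vw)) w≠

      within-branch : ∀ {w vw x y} → Branch v w vw x → Branch v w vw y → InStar x → InStar y → ¬ (x ~ y)
      within-branch end end _ _ = ~-irrefl
      within-branch {w} {vw} end (block i) x∈ (_ , _ , w≠) _ =
        w≠ (trans (cong (λ u → ρ (inj₁ u)) (other-edge v w vw)) (InStar-color _ x∈))
      within-branch {w} {vw} (block i) end (_ , _ , w≠) y∈ _ =
        w≠ (trans (cong (λ u → ρ (inj₁ u)) (other-edge v w vw)) (InStar-color _ y∈))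
      within-branch (block i) (block j) x∈ y∈ with i FP.≟ j
      ... | yes refl = ~-irrefl
      ... | no i≢j = λ _ → rainbow _ i j i≢j (trans (InStar-color _ x∈) (sym (InStar-color _ y∈)))

      independent : ∀ x y → InStar x → InStar y → x ≢ inj₁ v → y ≢ inj₁ v → ¬ (x ~ y)
      independent x y x∈ y∈ x≢v y≢v
        with neighbour-branch v x (InStar-neighbour x x∈ x≢v) | neighbour-branch v y (InStar-neighbour y y∈ y≢v)
      ... | wx , vwx , bx | wy , vwy , by with wx ≟ wy
      ...   | no wx≢wy = branches-independent bx by wx≢wy
      ...   | yes refl with Bool-UIP vwx vwy
      ...     | refl = within-branch bx by x∈ y∈

      Sv⁻ : ∀ {z} → Sv z ≡ true → InStar z
      Sv⁻ {z} = dec-true⁻ (InStar? z)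

      Sv⁺ : ∀ {z} → InStar z → Sv z ≡ true
      Sv⁺ {z} = dec-true (InStar? z)

      v∈Sv : Sv (inj₁ v) ≡ true
      v∈Sv = Sv⁺ (inj₁ refl)

      is-star : IsStar G Sv
      is-star with representative w₁ vw₁
      ... | r₁ , b₁ , r₁∈ = inj₁ v , v∈Sv , (r₁ , Sv⁺ r₁∈ , Branch⇒≢ b₁) ,
                            (λ z z∈ → InStar-neighbour z (Sv⁻ z∈)) ,
                            (λ x y x∈ y∈ → independent x y (Sv⁻ x∈) (Sv⁻ y∈))

      ∉Sv⇒≢ : ∀ {z r} → Sv z ≡ false → InStar r → z ≢ r
      ∉Sv⇒≢ z∉ r∈ refl with () ← trans (sym z∉) (Sv⁺ r∈)

      is-maximal : ∀ S′ → IsStar G S′ → ¬ ProperlyContained G Sv S′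
      is-maximal S′ (c′ , _ , _ , c′~ , indep′) (⊆S′ , z , z∈S′ , z∉Sv) with c′ ≟ᵥ inj₁ v
      ... | yes refl with neighbour-branch v z (c′~ z z∈S′ (∉Sv⇒≢ z∉Sv (inj₁ refl)))
      ...   | w , vw , b with representative w vw
      ...     | r , br , r∈ = indep′ z r z∈S′ (⊆S′ r (Sv⁺ r∈)) (∉Sv⇒≢ z∉Sv (inj₁ refl)) (Branch⇒≢ br)
                               (Branch-clique b br (∉Sv⇒≢ z∉Sv r∈))
      is-maximal S′ (c′ , _ , _ , c′~ , indep′) (⊆S′ , _) | no c′≢v
        with representative w₁ vw₁ | representative w₂ vw₂
      ... | r₁ , b₁ , r₁∈ | r₂ , b₂ , r₂∈ with r₁ ≟ᵥ c′
      ...   | no r₁≢c′ = indep′ (inj₁ v) r₁ (⊆S′ _ v∈Sv) (⊆S′ r₁ (Sv⁺ r₁∈)) (c′≢v ∘ sym) r₁≢c′ (Branch⇒neighbour b₁)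
      ...   | yes refl = indep′ (inj₁ v) r₂ (⊆S′ _ v∈Sv) (⊆S′ r₂ (Sv⁺ r₂∈)) (c′≢v ∘ sym) r₂≢r₁ (Branch⇒neighbour b₂)
        where
        r₂≢r₁ : r₂ ≢ r₁
        r₂≢r₁ refl = w₁≢w₂ (Branch-unique b₁ b₂)

      absurd : ⊥
      absurd = star Sv (is-star , is-maximal)
        λ x y x∈ y∈ → trans (InStar-color x (Sv⁻ x∈)) (sym (InStar-color y (Sv⁻ y∈)))

    good-neighbour : ∀ v w₁ w₂ → Adj v w₁ → Adj v w₂ → w₁ ≢ w₂ → ∃ (GoodNeighbour ρ v)
    good-neighbour v w₁ w₂ vw₁ vw₂ w₁≢w₂ with FP.any? (GoodNeighbour? v)
    ... | yes found = found
    ... | no no-good = ⊥-elim (WithoutGoodNeighbour.absurd v w₁ w₂ vw₁ vw₂ w₁≢w₂ no-good)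

-- c-subtrees

module CSubtrees (N : Netblock) where
  open Netblock N
  open TreeFacts T
  module FinSubsets = DecSubsets _≟_
  open FinSubsets using (insert; ∈-insert-new; ∈-insert-old; ∈-insert⁻)

  InsideEdge-edge : ∀ {S : Fin n → Bool} u v uv → S u ≡ true → S v ≡ true → InsideEdge N S (edge u v uv)
  InsideEdge-edge u v uv u∈S v∈S with edge-ends u v uv
  ... | inj₁ eq rewrite eq = u∈S , v∈S
  ... | inj₂ eq rewrite eq = v∈S , u∈S

  module Extend (c : ℕ) (S : Fin n → Bool) (S-sub : IsCSubtree N c S)
                (v w : Fin n) (vw : Adj v w) (v∈S : S v ≡ true) (w∉S : S w ≡ false)
                (K≡c : K (edge v w vw) ≡ c) where

    S′ : Fin n → Bool
    S′ = insert w S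

    walks : ∀ x y → S x ≡ true → S y ≡ true → WalkIn adj S x y
    walks = proj₁ (proj₂ S-sub)

    ⊆S′ : ∀ x → S x ≡ true → S′ x ≡ true
    ⊆S′ x = ∈-insert-old w S

    -- an edge uw ≠ vw with u ∈ S would close a cycle through the walk from u to v
    into-w : ∀ u (uw : Adj u w) → S u ≡ true → K (edge u w uw) ≡ c
    into-w u uw u∈S with u ≟ v
    ... | yes refl = trans (cong K (edge-irrelevant u w uw vw)) K≡c
    ... | no u≢v with walk⇒Linked (walks u v u∈S v∈S)
    ...   | xs , l , last≡v = ⊥-elim (no-detour uw (xs ++ w ∷ []) detour (lastOf-++ u xs w))
      where
      avoiding : ∀ {x y} → AdjIn S x y → AdjAvoiding u w x y
      avoiding (xy , x∈S , y∈S) = xy , (λ (_ , y≡w) → ≢w y∈S y≡w) , (λ (x≡w , _) → ≢w x∈S x≡w)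
        where
        ≢w : ∀ {z} → S z ≡ true → z ≢ w
        ≢w z∈S refl with () ← trans (sym z∈S) w∉S
      detour : Linked (AdjAvoiding u w) (u ∷ xs ++ w ∷ [])
      detour = Linked-snoc xs (Linked.map avoiding l)
        (subst (λ t → AdjAvoiding u w t w) (sym last≡v) (vw , (λ (v≡u , _) → u≢v (sym v≡u)) , (λ (v≡w , _) → Adj⇒≢ vw v≡w)))

    is-subtree : IsCSubtree N c S′
    is-subtree = (v , ⊆S′ v v∈S) , walks′ , inside′
      where
      walks′ : ∀ x y → S′ x ≡ true → S′ y ≡ true → WalkIn adj S′ x y
      walks′ x y x∈ y∈ with ∈-insert⁻ w S x x∈ | ∈-insert⁻ w S y y∈
      ... | inj₁ x∈S | inj₁ y∈S = walk-mono ⊆S′ (walks x y x∈S y∈S)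
      ... | inj₁ x∈S | inj₂ refl = walk-snoc (walk-mono ⊆S′ (walks x v x∈S v∈S)) (∈-insert-new w S) vw
      ... | inj₂ refl | inj₁ y∈S = step (∈-insert-new w S) (Adj-sym vw) (walk-mono ⊆S′ (walks v y v∈S y∈S))
      ... | inj₂ refl | inj₂ refl = here (∈-insert-new w S)
      inside′ : ∀ e → InsideEdge N S′ e → K e ≡ c
      inside′ e@((x , y) , x<y , xy) (x∈ , y∈) with ∈-insert⁻ w S x x∈ | ∈-insert⁻ w S y y∈
      ... | inj₁ x∈S | inj₁ y∈S = proj₂ (proj₂ S-sub) e (x∈S , y∈S)
      ... | inj₂ refl | inj₂ refl = ⊥-elim (FP.<-irrefl refl x<y)
      ... | inj₁ x∈S | inj₂ refl = trans (cong K (edge-η e)) (into-w x xy x∈S)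
      ... | inj₂ refl | inj₁ y∈S =
        trans (cong K (trans (edge-η e) (edge-sym w y xy (Adj-sym xy)))) (into-w y (Adj-sym xy) y∈S)

    proper : (∀ x → S x ≡ true → S′ x ≡ true) × Σ (Fin n) (λ x → S′ x ≡ true × S x ≡ false)
    proper = ⊆S′ , w , ∈-insert-new w S , w∉S

  CEdge : ℕ → Fin n → Fin n → Set
  CEdge c u x = Σ (Adj u x) λ ux → K (edge u x ux) ≡ c

  CEdge? : ∀ c u x → Dec (CEdge c u x)
  CEdge? c u x with adj u x Bool.≟ true
  ... | no ¬ux = no (¬ux ∘ proj₁)
  ... | yes ux with K (edge u x ux) ℕP.≟ c
  ...   | yes K≡c = yes (ux , K≡c)
  ...   | no K≢c = no λ (ux′ , K≡c) → K≢c (subst (λ a → K (edge u x a) ≡ c) (Bool-UIP ux′ ux) K≡c)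

  CEdge-sym : ∀ {c u x} → CEdge c u x → CEdge c x u
  CEdge-sym {u = u} {x} (ux , K≡c) = Adj-sym ux , trans (cong K (edge-sym x u (Adj-sym ux) ux)) K≡c

  LowEdge : ℕ → Fin n → Fin n → Set
  LowEdge c v w = Σ (Adj v w) λ vw → K (edge v w vw) < c

  LowEdge? : ∀ c v w → Dec (LowEdge c v w)
  LowEdge? c v w with adj v w Bool.≟ true
  ... | no ¬vw = no (¬vw ∘ proj₁)
  ... | yes vw with K (edge v w vw) ℕP.<? c
  ...   | yes K<c = yes (vw , K<c)
  ...   | no K≮c = no λ (vw′ , K<c) → K≮c (subst (λ a → K (edge v w a) < c) (Bool-UIP vw′ vw) K<c)

  LowEdge-sym : ∀ {c v w} → LowEdge c v w → LowEdge c w v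
  LowEdge-sym {c} {v} {w} (vw , K<c) = Adj-sym vw , subst (_< c) (cong K (edge-sym v w vw (Adj-sym vw))) K<c

  module Component (c : ℕ) (v : Fin n) where
    open Reach (CEdge c) (CEdge? c) FinSubsets.｛ v ｝

    C : Fin n → Bool
    C = reach n

    C⁻ : ∀ u → C u ≡ true → Σ (List (Fin n)) λ xs → Linked (CEdge c) (u ∷ xs) × lastOf u xs ≡ v
    C⁻ u u∈C with reach-sound n u u∈C
    ... | xs , l , last∈ = xs , l , FinSubsets.∈-｛｝⁻ last∈

    C⁺ : ∀ u xs → Linked (CEdge c) (u ∷ xs) → lastOf u xs ≡ v → C u ≡ true
    C⁺ u xs l last≡v = reach-within-n u xs l (subst (λ t → FinSubsets.｛ v ｝ t ≡ true) (sym last≡v) (FinSubsets.∈-｛｝ v))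

    v∈C : C v ≡ true
    v∈C = C⁺ v [] [-] refl

    walk-to-v : ∀ u xs → Linked (CEdge c) (u ∷ xs) → lastOf u xs ≡ v → WalkIn adj C u v
    walk-to-v u [] l refl = here v∈C
    walk-to-v u (y ∷ ys) (uy ∷ l) last≡v = step (C⁺ u (y ∷ ys) (uy ∷ l) last≡v) (proj₁ uy) (walk-to-v y ys l last≡v)

    -- an edge inside C of weight ≠ c would close a cycle through v
    inside : ∀ e → InsideEdge N C e → K e ≡ c
    inside e@((x , y) , _ , xy) (x∈ , y∈) with K e ℕP.≟ c
    ... | yes K≡c = K≡c
    ... | no K≢c with C⁻ x x∈ | C⁻ y y∈
    ...   | xs , lx , lastx | ys , ly , lasty with Linked-reverse CEdge-sym y ys ly
    ...     | ys′ , ly′ , lasty′ with Linked-++ x xs ys′ lx (subst (λ t → Linked (CEdge c) (t ∷ ys′)) (trans lasty (sym lastx)) ly′)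
    ...       | l , last≡ = ⊥-elim (no-detour xy (xs ++ ys′) (Linked.map avoiding l)
                              (trans last≡ (trans (cong (λ t → lastOf t ys′) (trans lastx (sym lasty))) lasty′)))
      where
      K≢c′ : ∀ xy′ → K (edge x y xy′) ≢ c
      K≢c′ xy′ = K≢c ∘ trans (cong K (trans (edge-η e) (edge-irrelevant x y xy xy′)))
      avoiding : ∀ {a b} → CEdge c a b → AdjAvoiding x y a b
      avoiding ab = proj₁ ab , forward ab , backward ab
        where
        forward : ∀ {a b} → CEdge c a b → ¬ (a ≡ x × b ≡ y)
        forward (ab , K≡c) (refl , refl) = K≢c′ ab K≡c
        backward : ∀ {a b} → CEdge c a b → ¬ (a ≡ y × b ≡ x)
        backward ab (refl , refl) = let (ba , K≡c) = CEdge-sym ab in K≢c′ ba K≡c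

    is-maximal-subtree : IsMaximalCSubtree N c C
    is-maximal-subtree = ((v , v∈C) , walks , inside) , maximal
      where
      walks : ∀ x y → C x ≡ true → C y ≡ true → WalkIn adj C x y
      walks x y x∈ y∈ with C⁻ x x∈ | C⁻ y y∈
      ... | xs , lx , lastx | ys , ly , lasty = walk-++ (walk-to-v x xs lx lastx) (walk-reverse (walk-to-v y ys ly lasty))
      maximal : ∀ S′ → IsCSubtree N c S′ →
        ¬ ((∀ x → C x ≡ true → S′ x ≡ true) × Σ (Fin n) (λ x → S′ x ≡ true × C x ≡ false))
      maximal S′ (_ , walks′ , inside′) (C⊆S′ , x , x∈S′ , x∉C)
        with walk⇒Linked (walks′ v x (C⊆S′ v v∈C) x∈S′)
      ... | xs , l , last≡x with Linked-reverse CEdge-sym v xs (Linked.map c-edge l)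
        where
        c-edge : ∀ {a b} → AdjIn S′ a b → CEdge c a b
        c-edge (ab , a∈ , b∈) = ab , inside′ _ (InsideEdge-edge _ _ ab a∈ b∈)
      ...   | ys , l′ , last≡v with () ← trans (sym (C⁺ x ys (subst (λ t → Linked (CEdge c) (t ∷ ys)) last≡x l′)
                                               (trans (cong (λ t → lastOf t ys) (sym last≡x)) last≡v))) x∉C

-- (ii) ⇒ (iii)

module Necessity (N : Netblock) where
  open Netblock N
  open NetblockGraph N
  open CSubtrees N

  module _ (k : ℕ) (2≤n : 2 ≤ n) (ρ : V → Fin (suc k)) (star : IsStarColoring G ρ) where
    open StarColoringNecessary ρ star FP._≟_

    block-injective : ∀ e → Injective _≡_ _≡_ (λ i → ρ (inj₂ (e , i)))
    block-injective e {i} {j} eq with i FP.≟ j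
    ... | yes i≡j = i≡j
    ... | no i≢j = ⊥-elim (rainbow e i j i≢j eq)

    weight-bound : ∀ e → K e ≤ suc k
    weight-bound e = FP.injective⇒≤ (block-injective e)

    -- In a maximal k-subtree S without exit, every vertex has a good neighbour
    -- inside S along a k-edge, and following these neighbours never turns back.
    module WithoutExit (S : Fin n → Bool) (S-sub : IsCSubtree N k S)
                       (S-max : ∀ S′ → IsCSubtree N k S′ →
                          ¬ ((∀ x → S x ≡ true → S′ x ≡ true) × Σ (Fin n) (λ x → S′ x ≡ true × S x ≡ false)))
                       (no-exit : ¬ ∃ λ v → S v ≡ true × ∃ (LowEdge k v)) where

      record Successor (v : Fin n) : Set where
        field
          w : Fin n
          vw : Adj v w
          w∈S : S w ≡ true
          K≡k : K (edge v w vw) ≡ k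
          block≠ : ∀ i → ρ (inj₂ (edge v w vw , i)) ≢ ρ (inj₁ v)
          distinct-or-leaf : ρ (inj₁ w) ≢ ρ (inj₁ v) ⊎ Leaf v w

      -- a block avoiding ρ v has at most k vertices, and no edge at v is lighter than k
      stays-in-S : ∀ v w vw → S v ≡ true → (∀ i → ρ (inj₂ (edge v w vw , i)) ≢ ρ (inj₁ v)) →
        S w ≡ true × K (edge v w vw) ≡ k
      stays-in-S v w vw v∈S block≠ with S w in w∈S
      ... | true = refl , proj₂ (proj₂ S-sub) (edge v w vw) (InsideEdge-edge v w vw v∈S w∈S)
      ... | false with K (edge v w vw) ℕP.≟ k
      ...   | yes K≡k = ⊥-elim (S-max _ (Extend.is-subtree k S S-sub v w vw v∈S w∈S K≡k)
                                         (Extend.proper k S S-sub v w vw v∈S w∈S K≡k))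
      ...   | no K≢k = ⊥-elim (ℕP.<⇒≱ (ℕP.≤∧≢⇒< (ℕP.≮⇒≥ λ K<k → no-exit (v , v∈S , w , vw , K<k)) (K≢k ∘ sym))
                                      (injective-avoiding⇒≤ _ (ρ (inj₁ v)) (block-injective _) block≠))

      successor : ∀ v → S v ≡ true → Successor v
      successor v v∈S with has-neighbour 2≤n v
      ... | w₀ , vw₀ with FP.any? (λ u → (adj v u Bool.≟ true) ×-dec ¬? (u ≟ w₀))
      ...   | yes (u , vu , u≢w₀) with good-neighbour v w₀ u vw₀ vu (u≢w₀ ∘ sym)
      ...     | w , vw , w≠ , block≠ = record
        { w = w ; vw = vw ; w∈S = proj₁ (stays-in-S v w vw v∈S block≠)
        ; K≡k = proj₂ (stays-in-S v w vw v∈S block≠) ; block≠ = block≠ ; distinct-or-leaf = inj₁ w≠ }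
      successor v v∈S | w₀ , vw₀ | no ¬other = record
        { w = w₀ ; vw = vw₀ ; w∈S = proj₁ (stays-in-S v w₀ vw₀ v∈S block≠)
        ; K≡k = proj₂ (stays-in-S v w₀ vw₀ v∈S block≠) ; block≠ = block≠ ; distinct-or-leaf = inj₂ leaf }
        where
        leaf : Leaf v w₀
        leaf u vu = decidable-stable (u ≟ w₀) (λ u≢w₀ → ¬other (u , vu , u≢w₀))
        block≠ : ∀ i → ρ (inj₂ (edge v w₀ vw₀ , i)) ≢ ρ (inj₁ v)
        block≠ = leaf-block-distinct v w₀ vw₀ leaf

      -- on returning to v, the block B(vw) would avoid two colors, or v and w are leaves
      no-return : ∀ v (s : Successor v) → (s′ : Successor (Successor.w s)) → Successor.w s′ ≢ v
      no-return v s s′ refl with ρ (inj₁ v) FP.≟ ρ (inj₁ (Successor.w s))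
      ... | no ρv≢ρw = ℕP.<-irrefl (Successor.K≡k s)
            (injective-avoiding₂⇒< _ _ _ ρv≢ρw (block-injective _) (Successor.block≠ s) block≠w)
        where
        open Successor s
        block≠w : ∀ i → ρ (inj₂ (edge v w vw , i)) ≢ ρ (inj₁ w)
        block≠w i eq = let (i′ , same) = block-subst (edge-sym v w vw (Successor.vw s′)) i in
                       Successor.block≠ s′ i′ (trans (cong ρ (sym same)) eq)
      ... | yes ρv≡ρw with Successor.distinct-or-leaf s | Successor.distinct-or-leaf s′
      ...   | inj₁ w≠ | _ = w≠ (sym ρv≡ρw)
      ...   | inj₂ _ | inj₁ v≠ = v≠ ρv≡ρw
      ...   | inj₂ v-leaf | inj₂ w-leaf = leaves-distinct v (Successor.w s) (Successor.vw s) v-leaf w-leaf ρv≡ρw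

      walk : ℕ → Σ (Fin n) λ v → S v ≡ true
      walk zero = proj₁ S-sub
      walk (suc t) = let (v , v∈S) = walk t ; s = successor v v∈S in Successor.w s , Successor.w∈S s

      absurd : ⊥
      absurd = no-non-backtracking-walk (proj₁ ∘ walk)
        (λ t → Successor.vw (successor _ (proj₂ (walk t))))
        (λ t → no-return _ (successor _ (proj₂ (walk t))) (successor _ (proj₂ (walk (suc t)))))

    has-exit : ∀ S → IsMaximalCSubtree N k S → Σ (Fin n) λ v → S v ≡ true × IsExit N k v
    has-exit S (S-sub , S-max) with FP.any? (λ v → (S v Bool.≟ true) ×-dec FP.any? (LowEdge? k v))
    ... | yes (v , v∈S , w , vw , K<k) = v , v∈S , edge v w vw , Incident-edgeˡ v w vw , K<k
    ... | no no-exit = ⊥-elim (WithoutExit.absurd S S-sub S-max no-exit)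

  star-coloring⇒condition-iii : ∀ k → 2 ≤ n → HasStarColoring G k → Condition-iii N k
  star-coloring⇒condition-iii zero 2≤n (ρ , _) with ρ (inj₁ (F.fromℕ< nonempty))
  ... | ()
  star-coloring⇒condition-iii (suc k) 2≤n (ρ , star) = weight-bound k 2≤n ρ star , has-exit k 2≤n ρ star

-- (iii) ⇒ (i)

module Sufficiency (N : Netblock) where
  open Netblock N
  open NetblockGraph N
  open CSubtrees N

  module _ (d : ℕ) (cond : Condition-iii N (2 + d)) where

    c k : ℕ
    c = 1 + d
    k = 2 + d

    Exit : Fin n → Set
    Exit v = ∃ (LowEdge c v)

    exit : Fin n → Bool
    exit v = does (FP.any? (LowEdge? c v))

    exit⁺ : ∀ {v w} → LowEdge c v w → exit v ≡ true
    exit⁺ {v} {w} vw = dec-true (FP.any? (LowEdge? c v)) (w , vw)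

    exit⁻ : ∀ {v} → exit v ≡ true → Exit v
    exit⁻ {v} = dec-true⁻ (FP.any? (LowEdge? c v))

    open Reach (CEdge c) (CEdge? c) exit

    -- the maximal c-subtree through v contains an exit vertex
    reaches-exit : ∀ v → reach n v ≡ true
    reaches-exit v with proj₂ cond (Component.C c v) (Component.is-maximal-subtree c v)
    ... | x , x∈C , e , x∈e , K<c with Incident⇒edge e x∈e
    ...   | w , xw , refl with Component.C⁻ c v x x∈C
    ...     | xs , l , last≡v with Linked-reverse CEdge-sym x xs l
    ...       | ys , l′ , last≡x = reach-within-n v ys (subst (λ t → Linked (CEdge c) (t ∷ ys)) last≡v l′)
                  (subst (λ t → exit t ≡ true) (sym (trans (cong (λ t → lastOf t ys) (sym last≡v)) last≡x))
                    (exit⁺ (xw , K<c)))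

    distance : Fin n → ℕ
    distance v = least (λ t → reach t v) n

    reach-distance : ∀ v → reach (distance v) v ≡ true
    reach-distance v = least-satisfies (λ t → reach t v) n n ℕP.≤-refl (reaches-exit v)

    distance-minimal : ∀ v t → reach t v ≡ true → distance v ≤ t
    distance-minimal v t = least-minimal (λ t → reach t v) n t

    distance≤n : ∀ v → distance v ≤ n
    distance≤n v = distance-minimal v n (reaches-exit v)

    closer-neighbour : ∀ v → exit v ≡ false → Σ (Fin n) λ x → CEdge c v x × distance x < distance v
    closer-neighbour v ¬exit with distance v in eq | reach-distance v
    ... | zero | r with () ← trans (sym r) ¬exit
    ... | suc t | r with reach-suc⁻ t v r
    ...   | inj₁ r′ with () ← trans (sym r′) (<least⇒false (λ t → reach t v) n t (subst (t <_) (sym eq) ℕP.≤-refl))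
    ...   | inj₂ (x , vx , r′) = x , vx , s≤s (distance-minimal x t r′)

    data Leans (v p : Fin n) : Set where
      at-exit : exit v ≡ true → LowEdge c v p → (∀ u → u F.< p → ¬ LowEdge c v u) → Leans v p
      toward-exit : exit v ≡ false → CEdge c v p → distance p < distance v → Leans v p

    leans : ∀ v → Σ (Fin n) (Leans v)
    leans v with exit v in eq
    ... | false = let (x , vx , closer) = closer-neighbour v eq in x , toward-exit eq vx closer
    ... | true with first-index (λ w → does (LowEdge? c v w))
    ...   | inj₁ (p , vp , before) =
              p , at-exit eq (dec-true⁻ (LowEdge? c v p) vp) (λ u u<p → dec-false⁻ (LowEdge? c v u) (before u u<p))
    ...   | inj₂ none with exit⁻ eq
    ...     | w , vw with () ← trans (sym (none w)) (dec-true (LowEdge? c v w) vw)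

    parent : Fin n → Fin n
    parent v = proj₁ (leans v)

    Adj-parent : ∀ v → Adj v (parent v)
    Adj-parent v with leans v
    ... | _ , at-exit _ (vp , _) _ = vp
    ... | _ , toward-exit _ (vp , _) _ = vp

    LowEdge-parent : ∀ v → exit v ≡ true → LowEdge c v (parent v)
    LowEdge-parent v ex with leans v
    ... | _ , at-exit _ vp _ = vp
    ... | _ , toward-exit ¬ex _ _ with () ← trans (sym ex) ¬ex

    parent-first : ∀ v w → exit v ≡ true → LowEdge c v w → parent v F.≤ w
    parent-first v w ex vw with leans v
    ... | _ , at-exit _ _ before = ℕP.≮⇒≥ λ w<p → before w w<p vw
    ... | _ , toward-exit ¬ex _ _ with () ← trans (sym ex) ¬ex

    CEdge-parent : ∀ v → exit v ≡ false → CEdge c v (parent v) × distance (parent v) < distance v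
    CEdge-parent v ¬ex with leans v
    ... | _ , toward-exit _ vp closer = vp , closer
    ... | _ , at-exit ex _ _ with () ← trans (sym ex) ¬ex

    exit-dec : ∀ v → exit v ≡ true ⊎ exit v ≡ false
    exit-dec v with exit v
    ... | true = inj₁ refl
    ... | false = inj₂ refl

    exit-parent : ∀ v → exit v ≡ true → exit (parent v) ≡ true
    exit-parent v ex = exit⁺ (LowEdge-sym (LowEdge-parent v ex))

    parent-parent≢ : ∀ v → exit v ≡ false → parent (parent v) ≢ v
    parent-parent≢ v ¬ex pp≡v with CEdge-parent v ¬ex | exit-dec (parent v)
    ... | (vp , K≡c) , _ | inj₁ ex =
      ℕP.<-irrefl K≡c (subst (_< c) (cong K (edge-sym (parent v) v (proj₁ low) vp)) (proj₂ low))
      where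
      low : LowEdge c (parent v) v
      low = subst (LowEdge c (parent v)) pp≡v (LowEdge-parent (parent v) ex)
    ... | _ , closer | inj₂ ¬ex′ = ℕP.<-irrefl refl
      (ℕP.<-trans (subst (λ t → distance t < distance (parent v)) pp≡v (proj₂ (CEdge-parent (parent v) ¬ex′))) closer)

    M : ℕ
    M = suc (suc (n + n))

    n+n<M : n + n < M
    n+n<M = ℕP.<-trans (ℕP.n<1+n _) (ℕP.n<1+n _)

    -- The color of v will only have to avoid the color of its target.  Of
    -- two exit vertices leaning on each other the smaller has no target; the
    -- rank strictly decreases along targets (exit ranks stay below M).
    data Target (v : Fin n) : Maybe (Fin n) → ℕ → Set where
      from-inner : exit v ≡ false → Target v (just (parent v)) (M * distance v)
      downward : exit v ≡ true → parent v F.< v → Target v (just (parent v)) (toℕ v + toℕ v)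
      mutual-root : exit v ≡ true → v F.< parent v → parent (parent v) ≡ v → Target v nothing (toℕ v + toℕ v)
      upward : exit v ≡ true → v F.< parent v → parent (parent v) ≢ v →
        Target v (just (parent v)) (suc (toℕ (parent v) + toℕ (parent v)))

    target-spec : ∀ v → Σ (Maybe (Fin n)) λ m → Σ ℕ (Target v m)
    target-spec v with exit-dec v
    ... | inj₂ ¬ex = _ , _ , from-inner ¬ex
    ... | inj₁ ex with FP.<-cmp (parent v) v
    ...   | tri< p<v _ _ = _ , _ , downward ex p<v
    ...   | tri≈ _ p≡v _ = ⊥-elim (Adj⇒≢ (Adj-parent v) (sym p≡v))
    ...   | tri> _ _ v<p with parent (parent v) ≟ v
    ...     | yes pp≡v = _ , _ , mutual-root ex v<p pp≡v
    ...     | no pp≢v = _ , _ , upward ex v<p pp≢v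

    target : Fin n → Maybe (Fin n)
    target v = proj₁ (target-spec v)

    rank : Fin n → ℕ
    rank v = proj₁ (proj₂ (target-spec v))

    Target-target : ∀ v → Target v (target v) (rank v)
    Target-target v = proj₂ (proj₂ (target-spec v))

    double-< : ∀ {x y} → x < y → x + x < y + y
    double-< x<y = ℕP.+-mono-< x<y x<y

    suc-double-< : ∀ {x y} → x < y → suc (x + x) < y + y
    suc-double-< {x} {y} x<y =
      ℕP.<-≤-trans (ℕP.n<1+n _) (subst (_≤ y + y) (cong suc (ℕP.+-suc x x)) (ℕP.+-mono-≤ x<y x<y))

    exit-rank<M : ∀ {v m r} → Target v m r → exit v ≡ true → r < M
    exit-rank<M (from-inner ¬ex) ex with () ← trans (sym ex) ¬ex
    exit-rank<M {v} (downward _ _) _ = ℕP.<-trans (double-< (FP.toℕ<n v)) n+n<M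
    exit-rank<M {v} (mutual-root _ _ _) _ = ℕP.<-trans (double-< (FP.toℕ<n v)) n+n<M
    exit-rank<M {v} (upward _ _ _) _ = ℕP.<-trans (suc-double-< (FP.toℕ<n (parent v))) n+n<M

    parent-parent≤ : ∀ v → exit v ≡ true → parent (parent v) F.≤ v
    parent-parent≤ v ex = parent-first (parent v) v (exit-parent v ex) (LowEdge-sym (LowEdge-parent v ex))

    exit-rank<inner-rank : ∀ {u m r} v → distance u < distance v → Target u m r → exit u ≡ true →
      r < M * distance v
    exit-rank<inner-rank v closer tu ex =
      ℕP.<-≤-trans (exit-rank<M tu ex) (ℕP.m≤m*n M (distance v) {{ℕ.>-nonZero (ℕP.≤-<-trans z≤n closer)}})

    rank-decreases : ∀ {v m r u m′ r′} → Target v m r → m ≡ just u → Target u m′ r′ → r′ < r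
    rank-decreases {v} (from-inner ¬ex) refl (from-inner _) = ℕP.*-monoʳ-< M (proj₂ (CEdge-parent v ¬ex))
    rank-decreases {v} (from-inner ¬ex) refl tu@(downward ex _) =
      exit-rank<inner-rank v (proj₂ (CEdge-parent v ¬ex)) tu ex
    rank-decreases {v} (from-inner ¬ex) refl tu@(mutual-root ex _ _) =
      exit-rank<inner-rank v (proj₂ (CEdge-parent v ¬ex)) tu ex
    rank-decreases {v} (from-inner ¬ex) refl tu@(upward ex _ _) =
      exit-rank<inner-rank v (proj₂ (CEdge-parent v ¬ex)) tu ex
    rank-decreases {v} (downward ex _) refl (from-inner ¬ex′) with () ← trans (sym (exit-parent v ex)) ¬ex′
    rank-decreases (downward _ p<v) refl (downward _ _) = double-< p<v
    rank-decreases (downward _ p<v) refl (mutual-root _ _ _) = double-< p<v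
    rank-decreases {v} (downward ex _) refl (upward _ _ pp≢) =
      suc-double-< (FP.≤∧≢⇒< (parent-parent≤ v ex) λ pp≡v → pp≢ (cong parent pp≡v))
    rank-decreases (mutual-root _ _ _) () _
    rank-decreases {v} (upward ex _ _) refl (from-inner ¬ex′) with () ← trans (sym (exit-parent v ex)) ¬ex′
    rank-decreases (upward _ _ _) refl (downward _ _) = ℕP.n<1+n _
    rank-decreases {v} (upward ex v<p _) refl (mutual-root _ p<pp _) =
      ⊥-elim (ℕP.<-irrefl refl (ℕP.<-≤-trans p<pp (ℕP.≤-trans (parent-parent≤ v ex) (ℕP.<⇒≤ v<p))))
    rank-decreases {v} (upward ex v<p _) refl (upward _ p<pp _) =
      ⊥-elim (ℕP.<-irrefl refl (ℕP.<-≤-trans p<pp (ℕP.≤-trans (parent-parent≤ v ex) (ℕP.<⇒≤ v<p))))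

    rank-target< : ∀ v u → target v ≡ just u → rank u < rank v
    rank-target< v u eq = rank-decreases (Target-target v) eq (Target-target u)

    module ListColoring (L : V → List ℕ) (L-ok : IsListAssignment G k L) where

      choose : Maybe (Fin n) → (Fin n → ℕ) → Fin n → ℕ
      choose m f v = pick-avoiding (Maybe.map f m) (L (inj₁ v))

      choose-cong : ∀ m {f g} v → (∀ u → m ≡ just u → f u ≡ g u) → choose m f v ≡ choose m g v
      choose-cong nothing v _ = refl
      choose-cong (just u) v f≡g = cong (λ x → pick-avoiding (just x) (L (inj₁ v))) (f≡g u refl)

      color-after : ℕ → Fin n → ℕ
      color-after zero v = 0
      color-after (suc t) v = choose (target v) (color-after t) v

      stable : ∀ t v → rank v < t → color-after t v ≡ color-after (suc t) v
      stable (suc t) v rank<1+t = choose-cong (target v) v λ u eq →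
        stable t u (ℕP.<-≤-trans (rank-target< v u eq) (ℕP.≤-pred rank<1+t))

      rank-bound : ∀ v → rank v ≤ M * n + M
      rank-bound v = bound (Target-target v)
        where
        bound : ∀ {m r} → Target v m r → r ≤ M * n + M
        bound (from-inner _) = ℕP.≤-trans (ℕP.*-monoʳ-≤ M (distance≤n v)) (ℕP.m≤m+n (M * n) M)
        bound t@(downward ex _) = ℕP.≤-trans (ℕP.<⇒≤ (exit-rank<M t ex)) (ℕP.m≤n+m M (M * n))
        bound t@(mutual-root ex _ _) = ℕP.≤-trans (ℕP.<⇒≤ (exit-rank<M t ex)) (ℕP.m≤n+m M (M * n))
        bound t@(upward ex _ _) = ℕP.≤-trans (ℕP.<⇒≤ (exit-rank<M t ex)) (ℕP.m≤n+m M (M * n))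

      ρT : Fin n → ℕ
      ρT = color-after (suc (M * n + M))

      ρT-unfold : ∀ v → ρT v ≡ choose (target v) ρT v
      ρT-unfold v = choose-cong (target v) v λ u eq →
        stable (M * n + M) u (ℕP.<-≤-trans (rank-target< v u eq) (rank-bound v))

      2≤|L| : ∀ x → 2 ≤ length (L x)
      2≤|L| x = subst (2 ≤_) (sym (proj₁ (L-ok x))) (s≤s (s≤s z≤n))

      ρT∈L : ∀ v → ρT v ∈ L (inj₁ v)
      ρT∈L v = subst (_∈ L (inj₁ v)) (sym (ρT-unfold v))
        (pick-avoiding-∈ (Maybe.map ρT (target v)) (L (inj₁ v)) (proj₂ (L-ok (inj₁ v))) (2≤|L| (inj₁ v)))

      ρT≢target : ∀ v u → target v ≡ just u → ρT v ≢ ρT u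
      ρT≢target v u eq rewrite ρT-unfold v | eq =
        proj₂ (pick-other-spec (ρT u) (L (inj₁ v)) (proj₂ (L-ok (inj₁ v))) (2≤|L| (inj₁ v)))

      ρT≢parent : ∀ v → ρT v ≢ ρT (parent v)
      ρT≢parent v = via (Target-target v) (ρT≢target v)
        where
        via : ∀ {m r} → Target v m r → (∀ u → m ≡ just u → ρT v ≢ ρT u) → ρT v ≢ ρT (parent v)
        via (from-inner _) ≢target = ≢target (parent v) refl
        via (downward _ _) ≢target = ≢target (parent v) refl
        via (upward _ _ _) ≢target = ≢target (parent v) refl
        via (mutual-root ex v<p pp≡v) _ eq = from-parent (Target-target (parent v)) (ρT≢target (parent v))
          where
          from-parent : ∀ {m r} → Target (parent v) m r → (∀ u → m ≡ just u → ρT (parent v) ≢ ρT u) → ⊥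
          from-parent (downward _ _) ≢target = ≢target (parent (parent v)) refl (trans (sym eq) (cong ρT (sym pp≡v)))
          from-parent (from-inner ¬ex) _ with () ← trans (sym (exit-parent v ex)) ¬ex
          from-parent (mutual-root _ p<pp _) _ = FP.<-asym v<p (subst (parent v F.<_) pp≡v p<pp)
          from-parent (upward _ p<pp _) _ = FP.<-asym v<p (subst (parent v F.<_) pp≡v p<pp)

      when : ∀ {P : Set} → Dec P → ℕ → List ℕ
      when (yes _) x = x ∷ []
      when (no _) _ = []

      forbidden : Fin n × Fin n → List ℕ
      forbidden (x , y) = when (parent x ≟ y) (ρT x) ++ when (parent y ≟ x) (ρT y)

      K-leaning : ∀ a b ab → parent a ≡ b → K (edge a b ab) ≤ c
      K-leaning a .(parent a) ab refl with exit-dec a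
      ... | inj₁ ex = let (ab′ , K<c) = LowEdge-parent a ex in
                      ℕP.<⇒≤ (subst (_< c) (cong K (edge-irrelevant a (parent a) ab′ ab)) K<c)
      ... | inj₂ ¬ex = let ((ab′ , K≡c) , _) = CEdge-parent a ¬ex in
                       ℕP.≤-reflexive (trans (cong K (edge-irrelevant a (parent a) ab ab′)) K≡c)

      K-mutual : ∀ a b ab → parent a ≡ b → parent b ≡ a → K (edge a b ab) < c
      K-mutual a .(parent a) ab refl pp≡a with exit-dec a
      ... | inj₁ ex = let (ab′ , K<c) = LowEdge-parent a ex in
                      subst (_< c) (cong K (edge-irrelevant a (parent a) ab′ ab)) K<c
      ... | inj₂ ¬ex = ⊥-elim (parent-parent≢ a ¬ex pp≡a)

      forbidden-bound′ : ∀ x y xy (x→y : Dec (parent x ≡ y)) (y→x : Dec (parent y ≡ x)) →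
        length (when x→y (ρT x) ++ when y→x (ρT y)) + K (edge x y xy) ≤ k
      forbidden-bound′ x y xy (no _) (no _) = proj₁ cond (edge x y xy)
      forbidden-bound′ x y xy (yes x→y) (no _) = s≤s (K-leaning x y xy x→y)
      forbidden-bound′ x y xy (no _) (yes y→x) =
        s≤s (subst (_≤ c) (cong K (edge-sym y x (Adj-sym xy) xy)) (K-leaning y x (Adj-sym xy) y→x))
      forbidden-bound′ x y xy (yes x→y) (yes y→x) = s≤s (K-mutual x y xy x→y y→x)

      forbidden-bound : ∀ e → length (forbidden (ends e)) + K e ≤ k
      forbidden-bound e@((x , y) , _ , xy) =
        subst (λ t → length (forbidden (ends e)) + K t ≤ k) (sym (edge-η e))
          (forbidden-bound′ x y xy (parent x ≟ y) (parent y ≟ x))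

      ρT-forbidden : ∀ v → ρT v ∈ forbidden (ends (edge v (parent v) (Adj-parent v)))
      ρT-forbidden v with edge-ends v (parent v) (Adj-parent v)
      ... | inj₁ eq rewrite eq with parent v ≟ parent v
      ...   | yes _ = here refl
      ...   | no p≢p = ⊥-elim (p≢p refl)
      ρT-forbidden v | inj₂ eq rewrite eq with parent v ≟ parent v
      ...   | yes _ = ∈-++⁺ʳ (when (parent (parent v) ≟ v) (ρT (parent v))) (here refl)
      ...   | no p≢p = ⊥-elim (p≢p refl)

      block-coloring : ∀ e → Σ (Fin (K e) → ℕ) λ f → (∀ i → f i ∈ L (inj₂ (e , i))) ×
        (∀ i → f i ∉ forbidden (ends e)) × Injective _≡_ _≡_ f
      block-coloring e = distinct-representatives k (K e) (λ i → L (inj₂ (e , i))) (forbidden (ends e))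
        (λ i → proj₂ (L-ok _)) (λ i → proj₁ (L-ok _)) (forbidden-bound e)

      ρ : V → ℕ
      ρ (inj₁ v) = ρT v
      ρ (inj₂ (e , i)) = proj₁ (block-coloring e) i

      ρ∈L : ∀ x → ρ x ∈ L x
      ρ∈L (inj₁ v) = ρT∈L v
      ρ∈L (inj₂ (e , i)) = proj₁ (proj₂ (block-coloring e)) i

      parent-good : ∀ v → GoodNeighbour ρ v (parent v)
      parent-good v = Adj-parent v , ρT≢parent v ∘ sym , λ i ρc≡ρv →
        proj₁ (proj₂ (proj₂ (block-coloring e))) i (subst (_∈ forbidden (ends e)) (sym ρc≡ρv) (ρT-forbidden v))
        where
        e : Edge
        e = edge v (parent v) (Adj-parent v)

      is-star-coloring : IsStarColoring G ρ
      is-star-coloring = StarColoringCriterion.is-star-coloring ρ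
        (λ e i j i≢j eq → i≢j (proj₂ (proj₂ (proj₂ (block-coloring e))) eq))
        (λ v → parent v , parent-good v)

  no-0-exits : ¬ (∀ S → IsMaximalCSubtree N 0 S → Σ (Fin n) λ v → S v ≡ true × IsExit N 0 v)
  no-0-exits exits with exits _ (Component.is-maximal-subtree 0 (F.fromℕ< nonempty))
  ... | _ , _ , _ , _ , ()

  condition-iii⇒star-choosable : ∀ k → Condition-iii N k → StarChoosable G k
  condition-iii⇒star-choosable zero (_ , exits) = ⊥-elim (no-0-exits exits)
  condition-iii⇒star-choosable (suc zero) (_ , exits) = ⊥-elim (no-0-exits exits)
  condition-iii⇒star-choosable (suc (suc d)) cond L L-ok =
    ListColoring.ρ d cond L L-ok , ListColoring.ρ∈L d cond L L-ok , ListColoring.is-star-coloring d cond L L-ok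

-- (i) ⇒ (ii)

star-choosable⇒star-colorable : ∀ (G : Graph) k → StarChoosable G k → HasStarColoring G k
star-choosable⇒star-colorable G k choosable
  with choosable (λ _ → upTo k) (λ _ → length-upTo k , upTo⁺ k)
... | ρ , ρ∈ , star = ρ′ , λ S maximal mono → star S maximal λ x y x∈ y∈ →
    trans (sym (FP.toℕ-fromℕ< _)) (trans (cong toℕ (mono x y x∈ y∈)) (FP.toℕ-fromℕ< _))
  where
  ρ′ : Graph.V G → Fin k
  ρ′ v = F.fromℕ< (∈-upTo⁻ (ρ∈ v))

theorem44 : (k : ℕ) (N : Netblock) → 2 ≤ Tree.n (Netblock.T N) →
    (StarChoosable G[ N ] k ⇔ HasStarColoring G[ N ] k)
    × (HasStarColoring G[ N ] k ⇔ Condition-iii N k)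
theorem44 k N 2≤n =
  mk⇔ i⇒ii (iii⇒i ∘ ii⇒iii) , mk⇔ ii⇒iii (i⇒ii ∘ iii⇒i)
  where
  i⇒ii : StarChoosable G[ N ] k → HasStarColoring G[ N ] k
  i⇒ii = star-choosable⇒star-colorable G[ N ] k
  ii⇒iii : HasStarColoring G[ N ] k → Condition-iii N k
  ii⇒iii = Necessity.star-coloring⇒condition-iii N k 2≤n
  iii⇒i : Condition-iii N k → StarChoosable G[ N ] k
  iii⇒i = Sufficiency.condition-iii⇒star-choosable N k
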